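{- Let $n\ge 3$ be odd. Then there exists a balanced Gray code for $\mathcal{P}^{\mathrm{all}}_n$ starting at $12\cdots(n-1)n$ and ending at $12\cdots n(n-1)$, having $(n-1,n)$ as its closing transposition.
   Context: $S_n$ is the set of permutations of $[n]$ in one-line notation; a transposition $(i,j)$ acts by interchanging the entries $i$ and $j$. $\mathcal{P}^{\mathrm{all}}_n$ is the graph on $S_n$ whose edges join permutations differing by a transposition. A Gray code for $\mathcal{P}^{\mathrm{all}}_n$ is a listing $\pi_1,\dots,\pi_{n!}$ of all of $S_n$ with $\pi_{i+1}$ obtained from $\pi_i$ by a transposition; it is cyclic if $\pi_1$ is obtained from $\pi_{n!}$ by a transposition (the closing transposition), and a cyclic Gray code is balanced if, counting the closing transposition, each transposition occurs exactly $2(n-2)!$ times. -}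

module Defs where


open import Data.Nat using (ℕ; zero; suc; _*_; _∸_; _!; _≤_; _<_; s≤s; z≤n)
open import Data.Fin using (Fin; fromℕ; inject₁; toℕ) renaming (_≟_ to _≟ᶠ_)
open import Data.Fin.Permutation.Components using (transpose)
open import Data.Vec using (Vec; map; allFin; toList)
open import Data.Vec.Properties using (≡-dec)
open import Data.List using (List; []; _∷_; _++_; length; filter; zip; head; last)
open import Data.List.Relation.Unary.Linked using (Linked)
open import Data.List.Relation.Unary.Unique.Propositional using (Unique)
open import Data.List.Membership.Propositional using (_∈_)
open import Data.Maybe using (Maybe; just; nothing)
open import Data.Product using (_×_; _,_; ∃; proj₁; proj₂)
open import Relation.Binary.PropositionalEquality using (_≡_)
open import Relation.Nullary using (Dec)

-- A word of length n over the alphabet [n] = Fin n (entry k stands for k+1).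
Word : ℕ → Set
Word n = Vec (Fin n) n

-- One-line notation: π ∈ S_n iff every value occurs exactly once.
IsPerm : ∀ {n} → Word n → Set
IsPerm π = Unique (toList π)

-- The transposition (i,j) acting by interchanging the ENTRIES (values) i and j.
act : ∀ {n} → Fin n → Fin n → Word n → Word n
act i j π = map (transpose i j) π

Adjacent : ∀ {n} → Word n → Word n → Set
Adjacent {n} π σ = ∃ λ (i : Fin n) → ∃ λ (j : Fin n) → (toℕ i < toℕ j) × (σ ≡ act i j π)

IsGrayCode : (n : ℕ) → List (Word n) → Set
IsGrayCode n L =
  (∀ (π : Word n) → IsPerm π → π ∈ L) ×
  ((∀ (π : Word n) → π ∈ L → IsPerm π) ×
  (Unique L × Linked Adjacent L))

IsCyclic : (n : ℕ) → List (Word n) → Set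
IsCyclic n L = ∃ λ (x : Word n) → ∃ λ (y : Word n) →
  (head L ≡ just x) × ((last L ≡ just y) × Adjacent y x)

cyclicPairs : ∀ {A : Set} → List A → List (A × A)
cyclicPairs [] = []
cyclicPairs (x ∷ xs) = zip (x ∷ xs) (xs ++ (x ∷ []))

-- Number of steps (closing step included) realised by the transposition (i,j).
occurrences : ∀ {n} → Fin n → Fin n → List (Word n) → ℕ
occurrences i j L =
  length (filter (λ p → ≡-dec _≟ᶠ_ (proj₂ p) (act i j (proj₁ p))) (cyclicPairs L))

IsBalanced : (n : ℕ) → List (Word n) → Set
IsBalanced n L = ∀ (i j : Fin n) → toℕ i < toℕ j →
  occurrences i j L ≡ 2 * ((n ∸ 2) !)

identity : (n : ℕ) → Word n
identity n = allFin n

-- The transposition (n-1, n) (0-based entries n-2 and n-1), for n ≥ 3.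
lastTransp : (n : ℕ) → 3 ≤ n → Fin n × Fin n
lastTransp (suc (suc (suc m))) (s≤s (s≤s (s≤s _))) =
  inject₁ (fromℕ (suc m)) , fromℕ (suc (suc m))

swapLast : (n : ℕ) → 3 ≤ n → Word n → Word n
swapLast n h π = act (proj₁ (lastTransp n h)) (proj₂ (lastTransp n h)) π

module Submission where

-- Induction on odd n in steps of two. From a balanced code on m = n − 2 letters, list S_n in n rounds of
-- m + 1 blocks: with ρ the rotation x ↦ x − 1 (mod n) of values, block k of round c consists of the
-- permutations starting with the values ρᶜ 0, ρᶜ (k + 1), and runs through them as a relabelled copy of the
-- smaller code (or of a conjugate of it) on the last m positions. Consecutive blocks are joined by a
-- transposition of two cyclically consecutive values; within a round the first value stays and the second
-- is carried upwards, and after the last block of a round the positions of the tail are back in order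
-- because m is odd, so the next round is the previous one rotated by ρ.
-- Counting a transposition (i j): the joining transpositions and the closing transpositions of the copies
-- are both, summed over all rounds, m + 1 times every rotation of (0 n−1), so the count along the new code
-- equals the sum of the cyclic counts inside the blocks. A block contributes 2(m − 2)! when neither of its
-- two prefix values is i or j, and 0 otherwise; there are m(m − 1) such blocks, giving 2(n − 2)!.

open import Defs
open import Data.Nat using (ℕ; zero; suc; _+_; _*_; _∸_; _!; _%_; _≤_; _<_; s≤s; z≤n)
import Data.Nat.Properties as ℕP
open import Data.Nat.DivMod using ([m+n]%n≡m%n)
open import Data.Nat.Tactic.RingSolver using (solve-∀)
open import Algebra.Properties.CommutativeSemigroup ℕP.+-commutativeSemigroup using () renaming (interchange to +-interchange)
open import Data.Fin using (Fin; zero; suc; toℕ; fromℕ; inject₁; punchOut; opposite; #_) renaming (_≟_ to _≟ᶠ_)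
import Data.Fin.Properties as FP
open import Data.Fin.Permutation.Components using (transpose; transpose-inverse)
open import Data.Vec as V using (Vec; []; _∷_; lookup; tabulate; toList)
import Data.Vec.Properties as VP
open import Data.Vec.Properties using (≡-dec)
open import Data.List as L using (List; []; _∷_; _++_; length; filter; zip; head; last)
import Data.List.Properties as LP
open import Data.List.Relation.Unary.All as All using (All)
open import Data.List.Relation.Unary.AllPairs as AP using ()
open import Data.List.Relation.Unary.Any using (here; there)
open import Data.List.Relation.Unary.Linked as Lk using (Linked)
import Data.List.Relation.Unary.Linked.Properties as LkP
open import Data.List.Relation.Unary.Unique.Propositional using (Unique)
import Data.List.Relation.Unary.Unique.Propositional.Properties as UP
import Data.List.Relation.Unary.Unique.DecPropositional as UD
open import Data.List.Membership.Propositional using (_∈_)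
open import Data.List.Membership.Propositional.Properties using (∈-map⁺; ∈-map⁻; ∈-++⁺ˡ; ∈-++⁺ʳ; ∈-++⁻)
import Data.List.Membership.DecPropositional as DecMembership
open import Data.Maybe as Maybe using (just)
open import Data.Maybe.Relation.Binary.Connected using (Connected; just)
open import Data.Product using (_×_; _,_; ∃; proj₁; proj₂)
open import Data.Sum using (_⊎_; inj₁; inj₂)
open import Data.Empty using (⊥; ⊥-elim)
open import Function using (_∘_; id)
open import Function.Definitions using (Injective)
open import Relation.Nullary using (¬_; Dec; yes; no)
open import Relation.Nullary.Decidable using (from-yes; _→-dec_; _⊎-dec_; ¬?)
open import Relation.Unary using (Decidable)
open import Relation.Binary using (tri<; tri≈; tri>)
open import Relation.Binary.PropositionalEquality

Injective≡ : ∀ {A B : Set} → (A → B) → Set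
Injective≡ = Injective _≡_ _≡_

lookup-ext : ∀ {A : Set} {n} {u v : Vec A n} → (∀ i → lookup u i ≡ lookup v i) → u ≡ v
lookup-ext {u = u} {v} h = begin
  u                  ≡⟨ VP.tabulate∘lookup u ⟨
  tabulate (lookup u) ≡⟨ VP.tabulate-cong h ⟩
  tabulate (lookup v) ≡⟨ VP.tabulate∘lookup v ⟩
  v                  ∎
  where open ≡-Reasoning

All-lookup : ∀ {A : Set} {P : A → Set} {n} (xs : Vec A n) → All P (toList xs) → ∀ i → P (lookup xs i)
All-lookup (x ∷ xs) (px All.∷ _) zero = px
All-lookup (x ∷ xs) (_ All.∷ ps) (suc i) = All-lookup xs ps i

lookup-All : ∀ {A : Set} {P : A → Set} {n} (xs : Vec A n) → (∀ i → P (lookup xs i)) → All P (toList xs)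
lookup-All [] h = All.[]
lookup-All (x ∷ xs) h = h zero All.∷ lookup-All xs (h ∘ suc)

Unique⇒lookup-injective : ∀ {A : Set} {n} (v : Vec A n) → Unique (toList v) → Injective≡ (lookup v)
Unique⇒lookup-injective (x ∷ xs) (x∉xs AP.∷ _) {zero} {zero} _ = refl
Unique⇒lookup-injective (x ∷ xs) (x∉xs AP.∷ _) {zero} {suc j} eq = ⊥-elim (All-lookup xs x∉xs j eq)
Unique⇒lookup-injective (x ∷ xs) (x∉xs AP.∷ _) {suc i} {zero} eq = ⊥-elim (All-lookup xs x∉xs i (sym eq))
Unique⇒lookup-injective (x ∷ xs) (_ AP.∷ u) {suc i} {suc j} eq = cong suc (Unique⇒lookup-injective xs u eq)

lookup-injective⇒Unique : ∀ {A : Set} {n} (v : Vec A n) → Injective≡ (lookup v) → Unique (toList v)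
lookup-injective⇒Unique [] _ = AP.[]
lookup-injective⇒Unique (x ∷ xs) inj =
  lookup-All xs (λ i eq → 0≢suc (inj {zero} {suc i} eq)) AP.∷ lookup-injective⇒Unique xs (FP.suc-injective ∘ inj)
  where
  0≢suc : ∀ {n} {i : Fin n} → zero ≢ suc i
  0≢suc ()

-- Pigeonhole: a missed value y would let punchOut y inject Fin (suc n) into Fin n.
injective⇒surjective : ∀ {n} (f : Fin n → Fin n) → Injective≡ f → ∀ y → ∃ λ x → f x ≡ y
injective⇒surjective {zero} f inj ()
injective⇒surjective {suc n} f inj y with FP.any? (λ x → f x ≟ᶠ y)
... | yes hit = hit
... | no miss = ⊥-elim (ℕP.<-irrefl refl (FP.injective⇒≤ g-injective))
  where
  g : Fin (suc n) → Fin n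
  g x = punchOut {i = y} {j = f x} (λ eq → miss (x , sym eq))
  g-injective : Injective≡ g
  g-injective {a} {b} = inj ∘ FP.punchOut-injective (λ eq → miss (a , sym eq)) (λ eq → miss (b , sym eq))

IsPerm⇒lookup-injective : ∀ {n} (π : Word n) → IsPerm π → Injective≡ (lookup π)
IsPerm⇒lookup-injective = Unique⇒lookup-injective

IsPerm⇒lookup-surjective : ∀ {n} (π : Word n) → IsPerm π → ∀ y → ∃ λ x → lookup π x ≡ y
IsPerm⇒lookup-surjective π p = injective⇒surjective (lookup π) (IsPerm⇒lookup-injective π p)

-- Transpositions

transpose-matchˡ : ∀ {n} (i j : Fin n) → transpose i j i ≡ j
transpose-matchˡ i j with i ≟ᶠ i
... | yes _ = refl
... | no i≢i = ⊥-elim (i≢i refl)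

transpose-matchʳ : ∀ {n} (i j : Fin n) → transpose i j j ≡ i
transpose-matchʳ i j with j ≟ᶠ i
... | yes j≡i = j≡i
... | no _ with j ≟ᶠ j
...   | yes _ = refl
...   | no j≢j = ⊥-elim (j≢j refl)

transpose-noMatch : ∀ {n} (i j k : Fin n) → k ≢ i → k ≢ j → transpose i j k ≡ k
transpose-noMatch i j k k≢i k≢j with k ≟ᶠ i
... | yes k≡i = ⊥-elim (k≢i k≡i)
... | no _ with k ≟ᶠ j
...   | yes k≡j = ⊥-elim (k≢j k≡j)
...   | no _ = refl

data TransposeView {n} (i j k : Fin n) : Set where
  matchˡ : k ≡ i → TransposeView i j k
  matchʳ : k ≢ i → k ≡ j → TransposeView i j k
  noMatch : k ≢ i → k ≢ j → TransposeView i j k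

transposeView : ∀ {n} (i j k : Fin n) → TransposeView i j k
transposeView i j k with k ≟ᶠ i
... | yes k≡i = matchˡ k≡i
... | no k≢i with k ≟ᶠ j
...   | yes k≡j = matchʳ k≢i k≡j
...   | no k≢j = noMatch k≢i k≢j

transpose-comm : ∀ {n} (i j k : Fin n) → transpose i j k ≡ transpose j i k
transpose-comm i j k with transposeView i j k
... | matchˡ refl = trans (transpose-matchˡ k j) (sym (transpose-matchʳ j k))
... | matchʳ _ refl = trans (transpose-matchʳ i k) (sym (transpose-matchˡ k i))
... | noMatch k≢i k≢j = trans (transpose-noMatch i j k k≢i k≢j) (sym (transpose-noMatch j i k k≢j k≢i))

transpose-involutive : ∀ {n} (i j k : Fin n) → transpose i j (transpose i j k) ≡ k
transpose-involutive i j k = trans (cong (transpose i j) (transpose-comm i j k)) (transpose-inverse i j)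

transpose-injective : ∀ {n} (i j : Fin n) → Injective≡ (transpose i j)
transpose-injective i j {a} {b} eq =
  trans (sym (transpose-involutive i j a)) (trans (cong (transpose i j) eq) (transpose-involutive i j b))

transpose-conjugate : ∀ {m n} (f : Fin m → Fin n) → Injective≡ f →
  ∀ i j k → f (transpose i j k) ≡ transpose (f i) (f j) (f k)
transpose-conjugate f inj i j k with transposeView i j k
... | matchˡ refl = trans (cong f (transpose-matchˡ k j)) (sym (transpose-matchˡ (f k) (f j)))
... | matchʳ _ refl = trans (cong f (transpose-matchʳ i k)) (sym (transpose-matchʳ (f i) (f k)))
... | noMatch k≢i k≢j = trans (cong f (transpose-noMatch i j k k≢i k≢j))
      (sym (transpose-noMatch (f i) (f j) (f k) (k≢i ∘ inj) (k≢j ∘ inj)))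

SamePair : ∀ {n} → Fin n → Fin n → Fin n → Fin n → Set
SamePair u v i j = (u ≡ i × v ≡ j) ⊎ (u ≡ j × v ≡ i)

samePair? : ∀ {n} (u v i j : Fin n) → Dec (SamePair u v i j)
samePair? u v i j with u ≟ᶠ i | v ≟ᶠ j | u ≟ᶠ j | v ≟ᶠ i
... | yes a | yes b | _ | _ = yes (inj₁ (a , b))
... | _ | _ | yes c | yes d = yes (inj₂ (c , d))
... | no a | _ | no c | _ = no λ { (inj₁ (x , _)) → a x ; (inj₂ (x , _)) → c x }
... | no a | _ | yes c | no d = no λ { (inj₁ (x , _)) → a x ; (inj₂ (_ , y)) → d y }
... | yes a | no b | no c | _ = no λ { (inj₁ (_ , y)) → b y ; (inj₂ (x , _)) → c x }
... | yes a | no b | yes c | no d = no λ { (inj₁ (_ , y)) → b y ; (inj₂ (_ , y)) → d y }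

SamePair-swap : ∀ {n} {u v i j : Fin n} → SamePair u v i j → SamePair v u i j
SamePair-swap (inj₁ (a , b)) = inj₂ (b , a)
SamePair-swap (inj₂ (a , b)) = inj₁ (b , a)

transpose-ext⇒SamePair : ∀ {n} (u v i j : Fin n) → u ≢ v →
  (∀ y → transpose u v y ≡ transpose i j y) → SamePair u v i j
transpose-ext⇒SamePair u v i j u≢v same with transposeView i j u
... | matchˡ u≡i = inj₁ (u≡i , trans (sym (transpose-matchˡ u v)) (trans (same u) (trans (cong (transpose i j) u≡i) (transpose-matchˡ i j))))
... | matchʳ _ u≡j = inj₂ (u≡j , trans (sym (transpose-matchˡ u v)) (trans (same u) (trans (cong (transpose i j) u≡j) (transpose-matchʳ i j))))
... | noMatch u≢i u≢j = ⊥-elim (u≢v (trans (sym (transpose-noMatch i j u u≢i u≢j)) (trans (sym (same u)) (transpose-matchˡ u v))))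

act-comm : ∀ {n} (i j : Fin n) (w : Word n) → act i j w ≡ act j i w
act-comm i j = VP.map-cong (transpose-comm i j)

act-involutive : ∀ {n} (i j : Fin n) (w : Word n) → act i j (act i j w) ≡ w
act-involutive i j w = begin
  V.map (transpose i j) (V.map (transpose i j) w) ≡⟨ VP.map-∘ (transpose i j) (transpose i j) w ⟨
  V.map (transpose i j ∘ transpose i j) w         ≡⟨ VP.map-cong (transpose-involutive i j) w ⟩
  V.map id w                                      ≡⟨ VP.map-id w ⟩
  w                                               ∎
  where open ≡-Reasoning

lookup-act : ∀ {n} (i j : Fin n) (w : Word n) p → lookup (act i j w) p ≡ transpose i j (lookup w p)
lookup-act i j w p = VP.lookup-map p (transpose i j) w

act-tabulate : ∀ {n} (i j : Fin n) (f : Fin n → Fin n) → act i j (tabulate f) ≡ tabulate (transpose i j ∘ f)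
act-tabulate i j f = sym (VP.tabulate-∘ (transpose i j) f)

map-conjugate : ∀ {m n k} (f : Fin m → Fin n) → Injective≡ f → ∀ i j (w : Vec (Fin m) k) →
  V.map f (V.map (transpose i j) w) ≡ V.map (transpose (f i) (f j)) (V.map f w)
map-conjugate f inj i j w = begin
  V.map f (V.map (transpose i j) w)                 ≡⟨ VP.map-∘ f (transpose i j) w ⟨
  V.map (f ∘ transpose i j) w                       ≡⟨ VP.map-cong (transpose-conjugate f inj i j) w ⟩
  V.map (transpose (f i) (f j) ∘ f) w               ≡⟨ VP.map-∘ (transpose (f i) (f j)) f w ⟩
  V.map (transpose (f i) (f j)) (V.map f w)         ∎
  where open ≡-Reasoning

act-IsPerm : ∀ {n} (i j : Fin n) (w : Word n) → IsPerm w → IsPerm (act i j w)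
act-IsPerm i j w p = lookup-injective⇒Unique (act i j w) λ {a} {b} eq →
  IsPerm⇒lookup-injective w p (transpose-injective i j (trans (sym (lookup-act i j w a)) (trans eq (lookup-act i j w b))))

act-lookup : ∀ {n} (w : Word n) p q → IsPerm w →
  act (lookup w p) (lookup w q) w ≡ tabulate (lookup w ∘ transpose p q)
act-lookup w p q w-perm = lookup-ext λ r → begin
  lookup (act (lookup w p) (lookup w q) w) r            ≡⟨ lookup-act _ _ w r ⟩
  transpose (lookup w p) (lookup w q) (lookup w r)      ≡⟨ transpose-conjugate (lookup w) (IsPerm⇒lookup-injective w w-perm) p q r ⟨
  lookup w (transpose p q r)                            ≡⟨ VP.lookup∘tabulate _ r ⟨
  lookup (tabulate (lookup w ∘ transpose p q)) r        ∎
  where open ≡-Reasoning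

act≡act⇒SamePair : ∀ {n} (u v i j : Fin n) (w : Word n) → IsPerm w → u ≢ v → act u v w ≡ act i j w → SamePair u v i j
act≡act⇒SamePair u v i j w w-perm u≢v eq = transpose-ext⇒SamePair u v i j u≢v λ y →
  let (p , wp≡y) = IsPerm⇒lookup-surjective w w-perm y in begin
  transpose u v y                ≡⟨ cong (transpose u v) wp≡y ⟨
  transpose u v (lookup w p)     ≡⟨ lookup-act u v w p ⟨
  lookup (act u v w) p           ≡⟨ cong (λ w′ → lookup w′ p) eq ⟩
  lookup (act i j w) p           ≡⟨ lookup-act i j w p ⟩
  transpose i j (lookup w p)     ≡⟨ cong (transpose i j) wp≡y ⟩
  transpose i j y                ∎
  where open ≡-Reasoning

SamePair⇒act≡act : ∀ {n} (u v i j : Fin n) (w : Word n) → SamePair u v i j → act u v w ≡ act i j w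
SamePair⇒act≡act u v i j w (inj₁ (refl , refl)) = refl
SamePair⇒act≡act u v i j w (inj₂ (refl , refl)) = act-comm u v w

Adjacent-intro : ∀ {n} {π σ : Word n} (i j : Fin n) → i ≢ j → σ ≡ act i j π → Adjacent π σ
Adjacent-intro i j i≢j eq with ℕP.<-cmp (toℕ i) (toℕ j)
... | tri< i<j _ _ = i , j , i<j , eq
... | tri≈ _ i≡j _ = ⊥-elim (i≢j (FP.toℕ-injective i≡j))
... | tri> _ _ j<i = j , i , j<i , trans eq (act-comm i j _)

Adjacent-elim : ∀ {n} {π σ : Word n} → Adjacent π σ → ∃ λ i → ∃ λ j → (i ≢ j) × (σ ≡ act i j π)
Adjacent-elim (i , j , i<j , eq) = i , j , (λ i≡j → ℕP.<-irrefl (cong toℕ i≡j) i<j) , eq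

-- Cyclic listings and counting

module _ {A : Set} where

  last∷ : A → List A → A
  last∷ x [] = x
  last∷ x (y ∷ ys) = last∷ y ys

  last-∷ : ∀ (x : A) xs → last (x ∷ xs) ≡ just (last∷ x xs)
  last-∷ x [] = refl
  last-∷ x (y ∷ ys) = last-∷ y ys

  last∷-unique : ∀ (x : A) xs {y} → last (x ∷ xs) ≡ just y → last∷ x xs ≡ y
  last∷-unique x xs eq with trans (sym (last-∷ x xs)) eq
  ... | refl = refl

  last-++-∷ : ∀ (xs : List A) y ys → last (xs ++ y ∷ ys) ≡ last (y ∷ ys)
  last-++-∷ [] y ys = refl
  last-++-∷ (x ∷ []) y ys = refl
  last-++-∷ (x ∷ x′ ∷ xs) y ys = last-++-∷ (x′ ∷ xs) y ys

  pairsTo : A → List A → List (A × A)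
  pairsTo z [] = []
  pairsTo z (x ∷ []) = (x , z) ∷ []
  pairsTo z (x ∷ y ∷ r) = (x , y) ∷ pairsTo z (y ∷ r)

  cyclicPairs-∷ : ∀ (x : A) xs → cyclicPairs (x ∷ xs) ≡ pairsTo x (x ∷ xs)
  cyclicPairs-∷ z = go z
    where
    go : ∀ x xs → zip (x ∷ xs) (xs ++ z ∷ []) ≡ pairsTo z (x ∷ xs)
    go x [] = refl
    go x (y ∷ r) = cong ((x , y) ∷_) (go y r)

  pairsTo-++ : ∀ (z x : A) xs y ys → pairsTo z ((x ∷ xs) ++ (y ∷ ys)) ≡ pairsTo y (x ∷ xs) ++ pairsTo z (y ∷ ys)
  pairsTo-++ z x [] y ys = refl
  pairsTo-++ z x (w ∷ ws) y ys = cong ((x , w) ∷_) (pairsTo-++ z w ws y ys)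

  Linked⇒All-pairsTo : ∀ {R : A → A → Set} z x xs → Linked R (x ∷ xs) → R (last∷ x xs) z →
    All (λ (p , q) → R p q) (pairsTo z (x ∷ xs))
  Linked⇒All-pairsTo z x [] _ r = r All.∷ All.[]
  Linked⇒All-pairsTo z x (y ∷ ys) (rxy Lk.∷ lk) r = rxy All.∷ Linked⇒All-pairsTo z y ys lk r

  pairsTo-∈ : ∀ z (x : A) xs → All (λ (p , _) → p ∈ x ∷ xs) (pairsTo z (x ∷ xs))
  pairsTo-∈ z x [] = here refl All.∷ All.[]
  pairsTo-∈ z x (y ∷ ys) = here refl All.∷ All.map there (pairsTo-∈ z y ys)

pairsTo-map : ∀ {A B : Set} (f : A → B) z xs →
  pairsTo (f z) (L.map f xs) ≡ L.map (λ (p , q) → f p , f q) (pairsTo z xs)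
pairsTo-map f z [] = refl
pairsTo-map f z (x ∷ []) = refl
pairsTo-map f z (x ∷ y ∷ r) = cong ((f x , f y) ∷_) (pairsTo-map f z (y ∷ r))

indicator : ∀ {P : Set} → Dec P → ℕ
indicator (yes _) = 1
indicator (no _) = 0

module _ {A : Set} {P : A → Set} (P? : Decidable P) where

  count : List A → ℕ
  count xs = length (filter P? xs)

  count-++ : ∀ xs ys → count (xs ++ ys) ≡ count xs + count ys
  count-++ xs ys = trans (cong length (LP.filter-++ P? xs ys)) (LP.length-++ (filter P? xs))

  count-none : ∀ {xs} → All (λ x → ¬ P x) xs → count xs ≡ 0
  count-none none = cong length (LP.filter-none P? none)

  count-map : ∀ {B : Set} (f : B → A) xs → count (L.map f xs) ≡ length (filter (P? ∘ f) xs)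
  count-map f [] = refl
  count-map f (x ∷ xs) with P? (f x)
  ... | yes _ = cong suc (count-map f xs)
  ... | no _ = count-map f xs

count-cong : ∀ {A : Set} {P Q : A → Set} (P? : Decidable P) (Q? : Decidable Q) xs →
  All (λ x → (P x → Q x) × (Q x → P x)) xs → count P? xs ≡ count Q? xs
count-cong P? Q? [] _ = refl
count-cong P? Q? (x ∷ xs) ((P⇒Q , Q⇒P) All.∷ h) with P? x | Q? x
... | yes _ | yes _ = cong suc (count-cong P? Q? xs h)
... | yes p | no ¬q = ⊥-elim (¬q (P⇒Q p))
... | no ¬p | yes q = ⊥-elim (¬p (Q⇒P q))
... | no _ | no _ = count-cong P? Q? xs h

StepBy : ∀ {n} → Fin n → Fin n → Word n × Word n → Set
StepBy i j (p , q) = q ≡ act i j p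

stepBy? : ∀ {n} (i j : Fin n) → Decidable (StepBy i j)
stepBy? i j (p , q) = ≡-dec _≟ᶠ_ q (act i j p)

count-pairsTo-retarget : ∀ {A : Set} {P : A × A → Set} (P? : Decidable P) z z′ x xs →
  count P? (pairsTo z (x ∷ xs)) + count P? ((last∷ x xs , z′) ∷ []) ≡
  count P? (pairsTo z′ (x ∷ xs)) + count P? ((last∷ x xs , z) ∷ [])
count-pairsTo-retarget P? z z′ x [] = ℕP.+-comm (count P? ((x , z) ∷ [])) _
count-pairsTo-retarget P? z z′ x (y ∷ r) = begin
  count P? ((x , y) ∷ pairsTo z (y ∷ r)) + last-to z′        ≡⟨ cong (_+ last-to z′) (count-++ P? ((x , y) ∷ []) _) ⟩
  (first + count P? (pairsTo z (y ∷ r))) + last-to z′        ≡⟨ ℕP.+-assoc first _ (last-to z′) ⟩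
  first + (count P? (pairsTo z (y ∷ r)) + last-to z′)        ≡⟨ cong (first +_) (count-pairsTo-retarget P? z z′ y r) ⟩
  first + (count P? (pairsTo z′ (y ∷ r)) + last-to z)        ≡⟨ ℕP.+-assoc first _ (last-to z) ⟨
  (first + count P? (pairsTo z′ (y ∷ r))) + last-to z        ≡⟨ cong (_+ last-to z) (count-++ P? ((x , y) ∷ []) _) ⟨
  count P? ((x , y) ∷ pairsTo z′ (y ∷ r)) + last-to z        ∎
  where
  open ≡-Reasoning
  first = count P? ((x , y) ∷ [])
  last-to = λ w → count P? ((last∷ y r , w) ∷ [])

indicator-cong : ∀ {P Q : Set} (P? : Dec P) (Q? : Dec Q) → (P → Q) → (Q → P) → indicator P? ≡ indicator Q?
indicator-cong (yes _) (yes _) _ _ = refl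
indicator-cong (no _) (no _) _ _ = refl
indicator-cong (yes p) (no ¬q) P⇒Q _ = ⊥-elim (¬q (P⇒Q p))
indicator-cong (no ¬p) (yes q) _ Q⇒P = ⊥-elim (¬p (Q⇒P q))

count-singleton : ∀ {A : Set} {P : A → Set} (P? : Decidable P) x → count P? (x ∷ []) ≡ indicator (P? x)
count-singleton P? x with P? x
... | yes _ = refl
... | no _ = refl

-- Balanced codes

record BalancedCode (n : ℕ) (a b : Fin n) : Set where
  field
    list : List (Word n)
    complete : ∀ π → IsPerm π → π ∈ list
    sound : ∀ {π} → π ∈ list → IsPerm π
    unique : Unique list
    linked : Linked Adjacent list
    balanced : ∀ i j → i ≢ j → occurrences i j list ≡ 2 * ((n ∸ 2) !)
    head-list : head list ≡ just (identity n)
    last-list : last list ≡ just (act a b (identity n))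
    a≢b : a ≢ b

  list-∷ : ∃ λ xs → list ≡ identity n ∷ xs
  list-∷ with list | head-list
  ... | x ∷ xs | refl = xs , refl

  cyclicPairs-Adjacent : All (λ (p , q) → Adjacent p q × p ∈ list) (cyclicPairs list)
  cyclicPairs-Adjacent with list | head-list | last-list | linked
  ... | x ∷ xs | refl | last-x∷xs | lk rewrite cyclicPairs-∷ x xs =
    All.zipWith (λ (adj , mem) → adj , mem) (Linked⇒All-pairsTo x x xs lk closing , pairsTo-∈ x x xs)
    where
    closing : Adjacent (last∷ x xs) x
    closing = Adjacent-intro a b a≢b
      (trans (sym (act-involutive a b x)) (cong (act a b) (sym (last∷-unique x xs last-x∷xs))))

BalancedCode-comm : ∀ {n a b} → BalancedCode n a b → BalancedCode n b a
BalancedCode-comm {n} {a} {b} C = record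
  { BalancedCode C
  ; last-list = trans (BalancedCode.last-list C) (cong just (act-comm a b (identity n)))
  ; a≢b = BalancedCode.a≢b C ∘ sym
  }

record ActEmbedding (m n : ℕ) : Set where
  field
    embed : Word m → Word n
    relabel : Fin m → Fin n
    relabel-injective : Injective≡ relabel
    embed-act : ∀ u v w → embed (act u v w) ≡ act (relabel u) (relabel v) (embed w)
    embed-injective : Injective≡ embed
    embed-IsPerm : ∀ w → IsPerm w → IsPerm (embed w)

  embed-Adjacent : ∀ {p q} → Adjacent p q → Adjacent (embed p) (embed q)
  embed-Adjacent adj with Adjacent-elim adj
  ... | u , v , u≢v , refl = Adjacent-intro (relabel u) (relabel v) (u≢v ∘ relabel-injective) (embed-act u v _)

  embed-StepBy⇒SamePair : ∀ {i j s t} p → IsPerm p → s ≢ t →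
    StepBy i j (embed p , embed (act s t p)) → SamePair (relabel s) (relabel t) i j
  embed-StepBy⇒SamePair {i} {j} {s} {t} p p-perm s≢t step =
    act≡act⇒SamePair _ _ i j (embed p) (embed-IsPerm p p-perm) (s≢t ∘ relabel-injective) (trans (sym (embed-act s t p)) step)

  module Image {a b} (C : BalancedCode m a b) where
    private module C = BalancedCode C

    list : List (Word n)
    list = L.map embed C.list

    sound : ∀ {π} → π ∈ list → IsPerm π
    sound mem with ∈-map⁻ embed mem
    ... | w , w∈C , refl = embed-IsPerm w (C.sound w∈C)

    unique : Unique list
    unique = UP.map⁺ embed-injective C.unique

    linked : Linked Adjacent list
    linked = LkP.map⁺ (Lk.map embed-Adjacent C.linked)

    head-list : head list ≡ just (embed (identity m))
    head-list = trans (LP.head-map {f = embed} C.list) (cong (Maybe.map embed) C.head-list)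

    last-list : last list ≡ just (act (relabel a) (relabel b) (embed (identity m)))
    last-list = trans (LP.last-map embed C.list)
      (trans (cong (Maybe.map embed) C.last-list) (cong just (embed-act a b (identity m))))

    cyclicPairs-list : cyclicPairs list ≡ L.map (λ (p , q) → embed p , embed q) (cyclicPairs C.list)
    cyclicPairs-list with C.list | C.head-list
    ... | x ∷ xs | refl = trans (cyclicPairs-∷ (embed x) (L.map embed xs))
      (trans (pairsTo-map embed x (x ∷ xs)) (cong (L.map _) (sym (cyclicPairs-∷ x xs))))

    occurrences-list : ∀ i j →
      occurrences i j list ≡ length (filter (λ (p , q) → stepBy? i j (embed p , embed q)) (cyclicPairs C.list))
    occurrences-list i j = trans (cong (count (stepBy? i j)) cyclicPairs-list) (count-map (stepBy? i j) _ (cyclicPairs C.list))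

    occurrences-relabel : ∀ u v → occurrences (relabel u) (relabel v) list ≡ occurrences u v C.list
    occurrences-relabel u v = trans (occurrences-list (relabel u) (relabel v))
      (count-cong _ (stepBy? u v) _ (All.map same-step C.cyclicPairs-Adjacent))
      where
      same-step : ∀ {pq} → Adjacent (proj₁ pq) (proj₂ pq) × proj₁ pq ∈ C.list →
        (StepBy (relabel u) (relabel v) (embed (proj₁ pq) , embed (proj₂ pq)) → StepBy u v pq) ×
        (StepBy u v pq → StepBy (relabel u) (relabel v) (embed (proj₁ pq) , embed (proj₂ pq)))
      same-step {p , q} (adj , p∈C) with Adjacent-elim adj
      ... | s , t , s≢t , refl =
        (λ step → SamePair⇒act≡act s t u v p (unrelabel (embed-StepBy⇒SamePair p (C.sound p∈C) s≢t step)))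
        , (λ step → trans (cong embed step) (embed-act u v p))
        where
        unrelabel : SamePair (relabel s) (relabel t) (relabel u) (relabel v) → SamePair s t u v
        unrelabel (inj₁ (e₁ , e₂)) = inj₁ (relabel-injective e₁ , relabel-injective e₂)
        unrelabel (inj₂ (e₁ , e₂)) = inj₂ (relabel-injective e₁ , relabel-injective e₂)

    occurrences-unrelabelled : ∀ i j → (∀ s t → ¬ SamePair (relabel s) (relabel t) i j) → occurrences i j list ≡ 0
    occurrences-unrelabelled i j never = trans (occurrences-list i j) (count-none _ (All.map no-step C.cyclicPairs-Adjacent))
      where
      no-step : ∀ {pq} → Adjacent (proj₁ pq) (proj₂ pq) × proj₁ pq ∈ C.list → ¬ StepBy i j (embed (proj₁ pq) , embed (proj₂ pq))
      no-step {p , q} (adj , p∈C) step with Adjacent-elim adj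
      ... | s , t , s≢t , refl = never s t (embed-StepBy⇒SamePair p (C.sound p∈C) s≢t step)

module Conjugation {m} (σ : Fin m → Fin m) (σ-involutive : ∀ x → σ (σ x) ≡ x) where

  σ-injective : Injective≡ σ
  σ-injective {x} {y} eq = trans (sym (σ-involutive x)) (trans (cong σ eq) (σ-involutive y))

  conj : Word m → Word m
  conj w = tabulate (σ ∘ lookup w ∘ σ)

  lookup-conj : ∀ w p → lookup (conj w) p ≡ σ (lookup w (σ p))
  lookup-conj w = VP.lookup∘tabulate _

  conj-involutive : ∀ w → conj (conj w) ≡ w
  conj-involutive w = lookup-ext λ p →
    trans (lookup-conj (conj w) p) (trans (cong σ (lookup-conj w (σ p)))
      (trans (σ-involutive _) (cong (lookup w) (σ-involutive p))))

  conj-identity : conj (identity m) ≡ identity m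
  conj-identity = lookup-ext λ p →
    trans (lookup-conj (identity m) p) (trans (cong σ (VP.lookup-allFin (σ p)))
      (trans (σ-involutive p) (sym (VP.lookup-allFin p))))

  conj-act : ∀ u v w → conj (act u v w) ≡ act (σ u) (σ v) (conj w)
  conj-act u v w = lookup-ext λ p → begin
    lookup (conj (act u v w)) p                  ≡⟨ lookup-conj (act u v w) p ⟩
    σ (lookup (act u v w) (σ p))                 ≡⟨ cong σ (lookup-act u v w (σ p)) ⟩
    σ (transpose u v (lookup w (σ p)))           ≡⟨ transpose-conjugate σ σ-injective u v _ ⟩
    transpose (σ u) (σ v) (σ (lookup w (σ p)))   ≡⟨ cong (transpose (σ u) (σ v)) (lookup-conj w p) ⟨
    transpose (σ u) (σ v) (lookup (conj w) p)    ≡⟨ lookup-act (σ u) (σ v) (conj w) p ⟨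
    lookup (act (σ u) (σ v) (conj w)) p          ∎
    where open ≡-Reasoning

  conj-IsPerm : ∀ w → IsPerm w → IsPerm (conj w)
  conj-IsPerm w w-perm = lookup-injective⇒Unique (conj w) λ {p} {q} eq →
    σ-injective (IsPerm⇒lookup-injective w w-perm
      (σ-injective (trans (sym (lookup-conj w p)) (trans eq (lookup-conj w q)))))

  conjEmbedding : ActEmbedding m m
  conjEmbedding = record
    { embed = conj
    ; relabel = σ
    ; relabel-injective = σ-injective
    ; embed-act = conj-act
    ; embed-injective = λ {x} {y} eq → trans (sym (conj-involutive x)) (trans (cong conj eq) (conj-involutive y))
    ; embed-IsPerm = conj-IsPerm
    }

  conjugate : ∀ {a b} → BalancedCode m a b → BalancedCode m (σ a) (σ b)
  conjugate {a} {b} C = record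
    { list = list
    ; complete = λ π π-perm →
        subst (_∈ list) (conj-involutive π) (∈-map⁺ conj (BalancedCode.complete C (conj π) (conj-IsPerm π π-perm)))
    ; sound = sound
    ; unique = unique
    ; linked = linked
    ; balanced = λ i j i≢j → subst₂ (λ x y → occurrences x y list ≡ 2 * ((m ∸ 2) !)) (σ-involutive i) (σ-involutive j)
        (trans (occurrences-relabel (σ i) (σ j)) (BalancedCode.balanced C (σ i) (σ j) (i≢j ∘ σ-injective)))
    ; head-list = trans head-list (cong just conj-identity)
    ; last-list = trans last-list (cong (just ∘ act (σ a) (σ b)) conj-identity)
    ; a≢b = BalancedCode.a≢b C ∘ σ-injective
    }
    where open ActEmbedding.Image conjEmbedding C

module _ where
  open DecMembership (≡-dec {n = 3} (_≟ᶠ_ {3})) using (_∈?_)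

  list₃ : List (Word 3)
  list₃ = (# 0 ∷ # 1 ∷ # 2 ∷ []) ∷ (# 0 ∷ # 2 ∷ # 1 ∷ []) ∷ (# 2 ∷ # 0 ∷ # 1 ∷ [])
        ∷ (# 2 ∷ # 1 ∷ # 0 ∷ []) ∷ (# 1 ∷ # 2 ∷ # 0 ∷ []) ∷ (# 1 ∷ # 0 ∷ # 2 ∷ []) ∷ []

  complete₃ : ∀ π → IsPerm π → π ∈ list₃
  complete₃ (a ∷ b ∷ c ∷ []) = from-yes (FP.all? λ (x : Fin 3) → FP.all? λ y → FP.all? λ z →
    UD.unique? _≟ᶠ_ (toList (x ∷ y ∷ z ∷ [])) →-dec ((x ∷ y ∷ z ∷ []) ∈? list₃)) a b c

  code₃ : BalancedCode 3 zero (suc zero)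
  code₃ = record
    { list = list₃
    ; complete = complete₃
    ; sound = All.lookup (from-yes (All.all? (UD.unique? _≟ᶠ_ ∘ toList) list₃))
    ; unique = from-yes (UD.unique? (≡-dec _≟ᶠ_) list₃)
    ; linked = (# 1 , # 2 , ℕP.≤-refl , refl) Lk.∷ (# 0 , # 2 , s≤s z≤n , refl) Lk.∷ (# 0 , # 1 , ℕP.≤-refl , refl)
          Lk.∷ (# 1 , # 2 , ℕP.≤-refl , refl) Lk.∷ (# 0 , # 2 , s≤s z≤n , refl) Lk.∷ Lk.[-]
    ; balanced = from-yes (FP.all? λ i → FP.all? λ j → ¬? (i ≟ᶠ j) →-dec (occurrences i j list₃ ℕP.≟ 2))
    ; head-list = refl
    ; last-list = refl
    ; a≢b = λ ()
    }

-- Sums and concatenations over ranges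

sumUpTo : ℕ → (ℕ → ℕ) → ℕ
sumUpTo zero φ = 0
sumUpTo (suc ℓ) φ = sumUpTo ℓ φ + φ ℓ

syntax sumUpTo ℓ (λ i → e) = ∑[ i < ℓ ] e

∑-cong : ∀ ℓ {φ ψ : ℕ → ℕ} → (∀ i → i < ℓ → φ i ≡ ψ i) → sumUpTo ℓ φ ≡ sumUpTo ℓ ψ
∑-cong zero eq = refl
∑-cong (suc ℓ) eq = cong₂ _+_ (∑-cong ℓ λ i i<ℓ → eq i (ℕP.m<n⇒m<1+n i<ℓ)) (eq ℓ ℕP.≤-refl)

∑-distrib-+ : ∀ ℓ (φ ψ : ℕ → ℕ) → ∑[ i < ℓ ] (φ i + ψ i) ≡ sumUpTo ℓ φ + sumUpTo ℓ ψ
∑-distrib-+ zero φ ψ = refl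
∑-distrib-+ (suc ℓ) φ ψ = trans (cong (_+ (φ ℓ + ψ ℓ)) (∑-distrib-+ ℓ φ ψ))
  (+-interchange (sumUpTo ℓ φ) (sumUpTo ℓ ψ) (φ ℓ) (ψ ℓ))

∑-const : ∀ ℓ c → ∑[ i < ℓ ] c ≡ ℓ * c
∑-const zero c = refl
∑-const (suc ℓ) c = trans (cong (_+ c) (∑-const ℓ c)) (ℕP.+-comm (ℓ * c) c)

∑-*ˡ : ∀ ℓ x (φ : ℕ → ℕ) → ∑[ i < ℓ ] (x * φ i) ≡ x * sumUpTo ℓ φ
∑-*ˡ zero x φ = sym (ℕP.*-zeroʳ x)
∑-*ˡ (suc ℓ) x φ = trans (cong (_+ x * φ ℓ) (∑-*ˡ ℓ x φ)) (sym (ℕP.*-distribˡ-+ x (sumUpTo ℓ φ) (φ ℓ)))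

∑-*ʳ : ∀ ℓ x (φ : ℕ → ℕ) → ∑[ i < ℓ ] (φ i * x) ≡ sumUpTo ℓ φ * x
∑-*ʳ ℓ x φ = trans (∑-cong ℓ (λ i _ → ℕP.*-comm (φ i) x)) (trans (∑-*ˡ ℓ x φ) (ℕP.*-comm x _))

∑-comm : ∀ ℓ ℓ′ (F : ℕ → ℕ → ℕ) → ∑[ i < ℓ ] sumUpTo ℓ′ (F i) ≡ ∑[ k < ℓ′ ] ∑[ i < ℓ ] F i k
∑-comm zero ℓ′ F = sym (trans (∑-const ℓ′ 0) (ℕP.*-zeroʳ ℓ′))
∑-comm (suc ℓ) ℓ′ F = trans (cong (_+ sumUpTo ℓ′ (F ℓ)) (∑-comm ℓ ℓ′ F)) (sym (∑-distrib-+ ℓ′ _ (F ℓ)))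

∑-cons : ∀ ℓ (φ : ℕ → ℕ) → sumUpTo (suc ℓ) φ ≡ φ 0 + ∑[ i < ℓ ] φ (suc i)
∑-cons zero φ = ℕP.+-comm 0 (φ 0)
∑-cons (suc ℓ) φ = trans (cong (_+ φ (suc ℓ)) (∑-cons ℓ φ)) (ℕP.+-assoc (φ 0) _ (φ (suc ℓ)))

∑-periodic : ∀ ℓ (φ : ℕ → ℕ) → (∀ c → φ (c + ℓ) ≡ φ c) → ∀ α → ∑[ c < ℓ ] φ (c + α) ≡ sumUpTo ℓ φ
∑-periodic ℓ φ periodic zero = ∑-cong ℓ λ c _ → cong φ (ℕP.+-identityʳ c)
∑-periodic ℓ φ periodic (suc α) = trans shift (∑-periodic ℓ φ periodic α)
  where
  shift : ∑[ c < ℓ ] φ (c + suc α) ≡ ∑[ c < ℓ ] φ (c + α)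
  shift = ℕP.+-cancelʳ-≡ (φ (ℓ + α)) _ _ (begin
    ∑[ c < ℓ ] φ (c + suc α) + φ (ℓ + α)  ≡⟨ cong (_+ φ (ℓ + α)) (∑-cong ℓ λ c _ → cong φ (ℕP.+-suc c α)) ⟩
    ∑[ c < ℓ ] φ (suc c + α) + φ (ℓ + α)  ≡⟨ cong (∑[ c < ℓ ] φ (suc c + α) +_) (trans (cong φ (ℕP.+-comm ℓ α)) (periodic α)) ⟩
    ∑[ c < ℓ ] φ (suc c + α) + φ α        ≡⟨ ℕP.+-comm _ (φ α) ⟩
    φ (0 + α) + ∑[ c < ℓ ] φ (suc c + α)  ≡⟨ ∑-cons ℓ (λ c → φ (c + α)) ⟨
    ∑[ c < suc ℓ ] φ (c + α)              ∎)
    where open ≡-Reasoning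

∑-indicator-unique : ∀ {B : Set} (_≟_ : (x y : B) → Dec (x ≡ y)) (h : ℕ → B) y ℓ k →
  k < ℓ → h k ≡ y → (∀ i → i < ℓ → h i ≡ y → i ≡ k) → ∑[ i < ℓ ] indicator (h i ≟ y) ≡ 1
∑-indicator-unique _≟_ h y (suc ℓ) k k<1+ℓ hk≡y unique with h ℓ ≟ y
... | yes hℓ≡y = cong (_+ 1) (trans (∑-cong ℓ miss) (trans (∑-const ℓ 0) (ℕP.*-zeroʳ ℓ)))
  where
  miss : ∀ i → i < ℓ → indicator (h i ≟ y) ≡ 0
  miss i i<ℓ with h i ≟ y
  ... | no _ = refl
  ... | yes hi≡y = ⊥-elim (ℕP.<-irrefl (trans (unique i (ℕP.m<n⇒m<1+n i<ℓ) hi≡y)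
          (sym (unique ℓ ℕP.≤-refl hℓ≡y))) i<ℓ)
... | no hℓ≢y = trans (ℕP.+-identityʳ _) (∑-indicator-unique _≟_ h y ℓ k k<ℓ hk≡y
      λ i i<ℓ hi≡y → unique i (ℕP.m<n⇒m<1+n i<ℓ) hi≡y)
  where
  k<ℓ : k < ℓ
  k<ℓ = ℕP.≤∧≢⇒< (ℕP.≤-pred k<1+ℓ) λ k≡ℓ → hℓ≢y (trans (cong h (sym k≡ℓ)) hk≡y)

concatUpTo : ∀ {A : Set} → (ℕ → List A) → ℕ → List A
concatUpTo f zero = []
concatUpTo f (suc ℓ) = concatUpTo f ℓ ++ f ℓ

module _ {A : Set} where

  count-concatUpTo : ∀ {P : A → Set} (P? : Decidable P) f ℓ → count P? (concatUpTo f ℓ) ≡ ∑[ i < ℓ ] count P? (f i)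
  count-concatUpTo P? f zero = refl
  count-concatUpTo P? f (suc ℓ) = trans (count-++ P? (concatUpTo f ℓ) (f ℓ)) (cong (_+ count P? (f ℓ)) (count-concatUpTo P? f ℓ))

  StartsWith : (ℕ → List A) → (ℕ → A) → Set
  StartsWith f h = ∀ i → ∃ λ t → f i ≡ h i ∷ t

  module _ {f : ℕ → List A} {h : ℕ → A} (starts : StartsWith f h) where

    concatUpTo-∷ : ∀ ℓ → ∃ λ t → concatUpTo f (suc ℓ) ≡ h 0 ∷ t
    concatUpTo-∷ zero = starts 0
    concatUpTo-∷ (suc ℓ) with concatUpTo f (suc ℓ) | concatUpTo-∷ ℓ
    ... | _ | t , refl = t ++ f (suc ℓ) , refl

    last-concatUpTo : ∀ ℓ → last (concatUpTo f (suc ℓ)) ≡ last (f ℓ)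
    last-concatUpTo ℓ with f ℓ | starts ℓ
    ... | _ | t , refl = last-++-∷ (concatUpTo f ℓ) (h ℓ) t

    pairsTo-concatUpTo : ∀ z ℓ →
      pairsTo z (concatUpTo f (suc ℓ)) ≡ concatUpTo (λ i → pairsTo (h (suc i)) (f i)) ℓ ++ pairsTo z (f ℓ)
    pairsTo-concatUpTo z zero = refl
    pairsTo-concatUpTo z (suc ℓ) with concatUpTo f (suc ℓ) | concatUpTo-∷ ℓ | pairsTo-concatUpTo (h (suc ℓ)) ℓ
                                    | f (suc ℓ) | starts (suc ℓ)
    ... | _ | t , refl | ih | _ | t′ , refl =
      trans (pairsTo-++ z (h 0) t (h (suc ℓ)) t′) (cong (_++ pairsTo z (h (suc ℓ) ∷ t′)) ih)

    head-starts : ∀ i → head (f i) ≡ just (h i)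
    head-starts i with f i | starts i
    ... | _ | t , refl = refl

    Linked-concatUpTo : ∀ {R : A → A → Set} {e : ℕ → A} → (∀ i → Linked R (f i)) → (∀ i → last (f i) ≡ just (e i)) →
      ∀ ℓ → (∀ i → i < ℓ → R (e i) (h (suc i))) → Linked R (concatUpTo f (suc ℓ))
    Linked-concatUpTo lk ends zero link = lk 0
    Linked-concatUpTo {R} lk ends (suc ℓ) link = LkP.++⁺
      (Linked-concatUpTo lk ends ℓ λ i i<ℓ → link i (ℕP.m<n⇒m<1+n i<ℓ))
      (subst₂ (Connected R) (sym (trans (last-concatUpTo ℓ) (ends ℓ))) (sym (head-starts (suc ℓ))) (just (link ℓ ℕP.≤-refl)))
      (lk (suc ℓ))

  ∈-concatUpTo⁺ : ∀ (f : ℕ → List A) {x} ℓ i → i < ℓ → x ∈ f i → x ∈ concatUpTo f ℓ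
  ∈-concatUpTo⁺ f (suc ℓ) i i<1+ℓ x∈fi with i ℕP.≟ ℓ
  ... | yes refl = ∈-++⁺ʳ (concatUpTo f ℓ) x∈fi
  ... | no i≢ℓ = ∈-++⁺ˡ (∈-concatUpTo⁺ f ℓ i (ℕP.≤∧≢⇒< (ℕP.≤-pred i<1+ℓ) i≢ℓ) x∈fi)

  ∈-concatUpTo⁻ : ∀ (f : ℕ → List A) {x} ℓ → x ∈ concatUpTo f ℓ → ∃ λ i → i < ℓ × x ∈ f i
  ∈-concatUpTo⁻ f (suc ℓ) x∈ with ∈-++⁻ (concatUpTo f ℓ) x∈
  ... | inj₂ x∈fℓ = ℓ , ℕP.≤-refl , x∈fℓ
  ... | inj₁ x∈xs with ∈-concatUpTo⁻ f ℓ x∈xs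
  ...   | i , i<ℓ , x∈fi = i , ℕP.m<n⇒m<1+n i<ℓ , x∈fi

  Unique-concatUpTo : ∀ {B : Set} (f : ℕ → List A) (key : A → B) (s : ℕ → B) ℓ →
    (∀ i → Unique (f i)) → (∀ i {x} → i < ℓ → x ∈ f i → key x ≡ s i) →
    (∀ i i′ → i < ℓ → i′ < ℓ → s i ≡ s i′ → i ≡ i′) → Unique (concatUpTo f ℓ)
  Unique-concatUpTo f key s zero _ _ _ = AP.[]
  Unique-concatUpTo f key s (suc ℓ) u keyed s-injective = UP.++⁺
    (Unique-concatUpTo f key s ℓ u (λ i i<ℓ → keyed i (ℕP.m<n⇒m<1+n i<ℓ))
      (λ i i′ i<ℓ i′<ℓ → s-injective i i′ (ℕP.m<n⇒m<1+n i<ℓ) (ℕP.m<n⇒m<1+n i′<ℓ)))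
    (u ℓ) disjoint
    where
    disjoint : ∀ {x} → x ∈ concatUpTo f ℓ × x ∈ f ℓ → ⊥
    disjoint (x∈xs , x∈fℓ) with ∈-concatUpTo⁻ f ℓ x∈xs
    ... | i , i<ℓ , x∈fi = ℕP.<-irrefl (s-injective i ℓ (ℕP.m<n⇒m<1+n i<ℓ) ℕP.≤-refl
          (trans (sym (keyed i (ℕP.m<n⇒m<1+n i<ℓ) x∈fi)) (keyed ℓ ℕP.≤-refl x∈fℓ))) i<ℓ

*-pull-2 : ∀ a b c → a * (b * (2 * c)) ≡ 2 * (a * (b * c))
*-pull-2 = solve-∀

-- Rotation of values

clamp : ∀ N → ℕ → Fin (suc N)
clamp N zero = zero
clamp zero (suc x) = zero
clamp (suc N) (suc x) = suc (clamp N x)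

toℕ-clamp : ∀ N x → x ≤ N → toℕ (clamp N x) ≡ x
toℕ-clamp N zero _ = refl
toℕ-clamp (suc N) (suc x) (s≤s x≤N) = cong suc (toℕ-clamp N x x≤N)

transpose-noMatchℕ : ∀ {n} (i j k : Fin n) → toℕ k ≢ toℕ i → toℕ k ≢ toℕ j → transpose i j k ≡ k
transpose-noMatchℕ i j k k≢i k≢j = transpose-noMatch i j k (k≢i ∘ cong toℕ) (k≢j ∘ cong toℕ)

transpose-matchˡℕ : ∀ {n} (i j k : Fin n) → toℕ k ≡ toℕ i → transpose i j k ≡ j
transpose-matchˡℕ i j k k≡i rewrite FP.toℕ-injective {i = k} {j = i} k≡i = transpose-matchˡ i j

transpose-matchʳℕ : ∀ {n} (i j k : Fin n) → toℕ k ≡ toℕ j → transpose i j k ≡ i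
transpose-matchʳℕ i j k k≡j rewrite FP.toℕ-injective {i = k} {j = j} k≡j = transpose-matchʳ i j

rotate : ∀ {N} → Fin (suc N) → Fin (suc N)
rotate {N} zero = fromℕ N
rotate (suc x) = inject₁ x

rotateBy : ∀ {N} → ℕ → Fin (suc N) → Fin (suc N)
rotateBy zero x = x
rotateBy (suc c) x = rotate (rotateBy c x)

rotate-injective : ∀ {N} → Injective≡ (rotate {N})
rotate-injective {x = zero} {zero} _ = refl
rotate-injective {x = zero} {suc y} eq = ⊥-elim (FP.fromℕ≢inject₁ eq)
rotate-injective {x = suc x} {zero} eq = ⊥-elim (FP.fromℕ≢inject₁ (sym eq))
rotate-injective {x = suc x} {suc y} eq = cong suc (FP.inject₁-injective eq)

rotateBy-injective : ∀ {N} c → Injective≡ (rotateBy {N} c)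
rotateBy-injective zero eq = eq
rotateBy-injective (suc c) eq = rotateBy-injective c (rotate-injective eq)

rotateBy-+ : ∀ {N} a b (x : Fin (suc N)) → rotateBy (a + b) x ≡ rotateBy a (rotateBy b x)
rotateBy-+ zero b x = refl
rotateBy-+ (suc a) b x = cong rotate (rotateBy-+ a b x)

rotateBy-rotate : ∀ {N} c (x : Fin (suc N)) → rotateBy c (rotate x) ≡ rotate (rotateBy c x)
rotateBy-rotate c x = trans (sym (rotateBy-+ c 1 x)) (cong (λ d → rotateBy d x) (ℕP.+-comm c 1))

rotateBy-suc-zero : ∀ {N} c → rotateBy {N} (suc c) zero ≡ rotateBy c (fromℕ N)
rotateBy-suc-zero c = trans (cong (λ d → rotateBy d zero) (ℕP.+-comm 1 c)) (rotateBy-+ c 1 zero)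

toℕ-rotateBy : ∀ {N} c (x : Fin (suc N)) → c ≤ toℕ x → toℕ (rotateBy c x) ≡ toℕ x ∸ c
toℕ-rotateBy zero x _ = refl
toℕ-rotateBy (suc c) x c<x with rotateBy c x | toℕ-rotateBy c x (ℕP.<⇒≤ c<x)
... | zero | eq = ⊥-elim (ℕP.0≢1+n (trans eq (ℕP.+-∸-assoc 1 c<x)))
... | suc y | eq = trans (FP.toℕ-inject₁ y) (ℕP.suc-injective (trans eq (ℕP.+-∸-assoc 1 c<x)))

toℕ-rotateBy-fromℕ : ∀ {N} c → c ≤ N → toℕ (rotateBy c (fromℕ N)) ≡ N ∸ c
toℕ-rotateBy-fromℕ {N} c c≤N = trans (toℕ-rotateBy c (fromℕ N) (subst (c ≤_) (sym (FP.toℕ-fromℕ N)) c≤N))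
  (cong (_∸ c) (FP.toℕ-fromℕ N))

toℕ-rotateBy-zero : ∀ {N} c → c ≤ N → toℕ (rotateBy {N} (suc c) zero) ≡ N ∸ c
toℕ-rotateBy-zero c c≤N = trans (cong toℕ (rotateBy-suc-zero c)) (toℕ-rotateBy-fromℕ c c≤N)

-- Rotating x down to 0 takes toℕ x steps, one more step reaches N, and N − toℕ x more return to x.
rotateBy-period : ∀ {N} (x : Fin (suc N)) → rotateBy (suc N) x ≡ x
rotateBy-period {N} x = FP.toℕ-injective (begin
  toℕ (rotateBy (suc N) x)                        ≡⟨ cong (λ c → toℕ (rotateBy c x)) split ⟩
  toℕ (rotateBy ((N ∸ d) + suc d) x)              ≡⟨ cong toℕ (rotateBy-+ (N ∸ d) (suc d) x) ⟩
  toℕ (rotateBy (N ∸ d) (rotate (rotateBy d x)))  ≡⟨ cong (λ y → toℕ (rotateBy (N ∸ d) (rotate y))) reach-zero ⟩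
  toℕ (rotateBy (N ∸ d) (fromℕ N))                ≡⟨ toℕ-rotateBy-fromℕ (N ∸ d) (ℕP.m∸n≤m N d) ⟩
  N ∸ (N ∸ d)                                     ≡⟨ ℕP.m∸[m∸n]≡n d≤N ⟩
  d                                               ∎)
  where
  open ≡-Reasoning
  d = toℕ x
  d≤N : d ≤ N
  d≤N = FP.toℕ≤pred[n] x
  split : suc N ≡ (N ∸ d) + suc d
  split = sym (trans (ℕP.+-suc (N ∸ d) d) (cong suc (ℕP.m∸n+n≡m d≤N)))
  reach-zero : rotateBy d x ≡ zero
  reach-zero = FP.toℕ-injective (trans (toℕ-rotateBy d x ℕP.≤-refl) (ℕP.n∸n≡0 d))

rotateBy-periodic : ∀ {N} c (x : Fin (suc N)) → rotateBy (c + suc N) x ≡ rotateBy c x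
rotateBy-periodic c x = trans (rotateBy-+ c _ x) (cong (rotateBy c) (rotateBy-period x))

rotateBy-zero-injective : ∀ {N} c c′ → c < suc N → c′ < suc N → rotateBy {N} c zero ≡ rotateBy c′ zero → c ≡ c′
rotateBy-zero-injective zero zero _ _ _ = refl
rotateBy-zero-injective {N} zero (suc β) _ (s≤s β<N) eq =
  ⊥-elim (ℕP.<-irrefl (trans (cong toℕ eq) (toℕ-rotateBy-zero β (ℕP.<⇒≤ β<N))) (ℕP.m<n⇒0<n∸m β<N))
rotateBy-zero-injective {N} (suc β) zero (s≤s β<N) _ eq =
  ⊥-elim (ℕP.<-irrefl (trans (cong toℕ (sym eq)) (toℕ-rotateBy-zero β (ℕP.<⇒≤ β<N))) (ℕP.m<n⇒0<n∸m β<N))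
rotateBy-zero-injective {N} (suc β) (suc β′) (s≤s β<N) (s≤s β′<N) eq = cong suc (ℕP.∸-cancelˡ-≡ (ℕP.<⇒≤ β<N) (ℕP.<⇒≤ β′<N)
  (trans (sym (toℕ-rotateBy-zero β (ℕP.<⇒≤ β<N))) (trans (cong toℕ eq) (toℕ-rotateBy-zero β′ (ℕP.<⇒≤ β′<N)))))

rotateBy-zero-surjective : ∀ {N} (y : Fin (suc N)) → ∃ λ c → c < suc N × rotateBy c zero ≡ y
rotateBy-zero-surjective zero = 0 , s≤s z≤n , refl
rotateBy-zero-surjective {N} (suc y) = suc (N ∸ d) , s≤s (ℕP.∸-monoʳ-< {o = 0} (s≤s z≤n) d≤N) ,
  FP.toℕ-injective (trans (toℕ-rotateBy-zero (N ∸ d) (ℕP.m∸n≤m N d)) (ℕP.m∸[m∸n]≡n d≤N))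
  where
  d = toℕ (suc y)
  d≤N : d ≤ N
  d≤N = FP.toℕ≤pred[n] (suc y)

-- The inductive step: blocks

module Blocks (j : ℕ) where

  m N n : ℕ
  m = 3 + (j + j)
  N = suc m
  n = suc N

  fin : ℕ → Fin n
  fin = clamp N

  toℕ-fin : ∀ x → x ≤ N → toℕ (fin x) ≡ x
  toℕ-fin = toℕ-clamp N

  toℕ-fin≤m : ∀ x → x ≤ m → toℕ (fin x) ≡ x
  toℕ-fin≤m x x≤m = toℕ-fin x (ℕP.m≤n⇒m≤1+n x≤m)

  fin-injective : ∀ x y → x ≤ N → y ≤ N → fin x ≡ fin y → x ≡ y
  fin-injective x y x≤N y≤N eq = trans (sym (toℕ-fin x x≤N)) (trans (cong toℕ eq) (toℕ-fin y y≤N))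

  top : Fin n
  top = fromℕ N

  fin-top : fin (suc m) ≡ top
  fin-top = FP.toℕ-injective (trans (toℕ-fin (suc m) ℕP.≤-refl) (sym (FP.toℕ-fromℕ N)))

  -- raise k = (k k+1) ∘ ⋯ ∘ (1 2) carries the value 1 up to k + 1 and shifts 2, …, k + 1 down by one.
  raise : ℕ → Fin n → Fin n
  raise zero x = x
  raise (suc k) x = transpose (fin (suc k)) (fin (suc (suc k))) (raise k x)

  raise-injective : ∀ k → Injective≡ (raise k)
  raise-injective zero eq = eq
  raise-injective (suc k) eq = raise-injective k (transpose-injective _ _ eq)

  raiseℕ≥2 : ∀ k y → Dec (y < k) → ℕ
  raiseℕ≥2 k y (yes _) = suc y
  raiseℕ≥2 k y (no _) = suc (suc y)

  raiseℕ : ℕ → ℕ → ℕ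
  raiseℕ k zero = zero
  raiseℕ k (suc zero) = suc k
  raiseℕ k (suc (suc y)) = raiseℕ≥2 k y (y ℕP.<? k)

  raiseℕ-zero : ∀ v → raiseℕ 0 v ≡ v
  raiseℕ-zero zero = refl
  raiseℕ-zero (suc zero) = refl
  raiseℕ-zero (suc (suc y)) with y ℕP.<? 0
  ... | no _ = refl

  toℕ-raise-step : ∀ k (e : Fin n) v → suc k ≤ m → toℕ e ≡ raiseℕ k v →
    toℕ (transpose (fin (suc k)) (fin (suc (suc k))) e) ≡ raiseℕ (suc k) v
  toℕ-raise-step k e zero k<m e≡ = trans (cong toℕ (transpose-noMatchℕ _ _ e
    (λ eq → ℕP.0≢1+n (trans (sym e≡) (trans eq (toℕ-fin≤m (suc k) k<m))))
    (λ eq → ℕP.0≢1+n (trans (sym e≡) (trans eq (toℕ-fin (suc (suc k)) (s≤s k<m))))))) e≡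
  toℕ-raise-step k e (suc zero) k<m e≡ =
    trans (cong toℕ (transpose-matchˡℕ _ _ e (trans e≡ (sym (toℕ-fin≤m (suc k) k<m))))) (toℕ-fin (suc (suc k)) (s≤s k<m))
  toℕ-raise-step k e (suc (suc y)) k<m e≡ with y ℕP.<? k | y ℕP.<? suc k
  ... | yes y<k | yes _ = trans (cong toℕ (transpose-noMatchℕ _ _ e
          (λ eq → ℕP.<-irrefl (trans (sym e≡) (trans eq (toℕ-fin≤m (suc k) k<m))) (s≤s y<k))
          (λ eq → ℕP.<-irrefl (trans (sym e≡) (trans eq (toℕ-fin (suc (suc k)) (s≤s k<m)))) (s≤s (ℕP.m<n⇒m<1+n y<k))))) e≡
  ... | yes y<k | no y≮1+k = ⊥-elim (y≮1+k (ℕP.m<n⇒m<1+n y<k))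
  ... | no y≮k | y<1+k? with y ℕP.≟ k
  ...   | yes refl = trans (cong toℕ (transpose-matchʳℕ _ _ e (trans e≡ (sym (toℕ-fin (suc (suc y)) (s≤s k<m))))))
            (trans (toℕ-fin≤m (suc y) k<m) (lemma y<1+k?))
    where
    lemma : ∀ (d : Dec (y < suc y)) → suc y ≡ raiseℕ≥2 (suc y) y d
    lemma (yes _) = refl
    lemma (no y≮1+y) = ⊥-elim (y≮1+y (ℕP.n<1+n y))
  ...   | no y≢k = trans (cong toℕ (transpose-noMatchℕ _ _ e
            (λ eq → y≮k (ℕP.≤-reflexive (ℕP.suc-injective (trans (sym e≡) (trans eq (toℕ-fin≤m (suc k) k<m))))))
            (λ eq → y≢k (ℕP.suc-injective (ℕP.suc-injective (trans (sym e≡) (trans eq (toℕ-fin (suc (suc k)) (s≤s k<m)))))))))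
          (trans e≡ (lemma y<1+k?))
    where
    lemma : ∀ (d : Dec (y < suc k)) → suc (suc y) ≡ raiseℕ≥2 (suc k) y d
    lemma (yes y<1+k) = ⊥-elim (y≢k (ℕP.≤-antisym (ℕP.≤-pred y<1+k) (ℕP.≮⇒≥ y≮k)))
    lemma (no _) = refl

  toℕ-raise : ∀ k x → k ≤ m → toℕ (raise k x) ≡ raiseℕ k (toℕ x)
  toℕ-raise zero x _ = sym (raiseℕ-zero (toℕ x))
  toℕ-raise (suc k) x k<m = toℕ-raise-step k (raise k x) (toℕ x) k<m (toℕ-raise k x (ℕP.<⇒≤ k<m))

  raise-0 : ∀ k → k ≤ m → raise k zero ≡ zero
  raise-0 k k≤m = FP.toℕ-injective (toℕ-raise k zero k≤m)

  raise-1 : ∀ k → k ≤ m → raise k (suc zero) ≡ fin (suc k)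
  raise-1 k k≤m = FP.toℕ-injective (trans (toℕ-raise k (suc zero) k≤m) (sym (toℕ-fin (suc k) (s≤s k≤m))))

  transpose-raise-last : ∀ x → transpose zero (fin (suc m)) (raise m x) ≡ rotate x
  transpose-raise-last zero = begin
    transpose zero (fin (suc m)) (raise m zero) ≡⟨ cong (transpose zero (fin (suc m))) (raise-0 m ℕP.≤-refl) ⟩
    transpose zero (fin (suc m)) zero          ≡⟨ transpose-matchˡ zero (fin (suc m)) ⟩
    fin (suc m)                                ≡⟨ fin-top ⟩
    top                                        ∎
    where open ≡-Reasoning
  transpose-raise-last (suc zero) =
    transpose-matchʳℕ _ _ _ (trans (toℕ-raise m (suc zero) ℕP.≤-refl) (sym (toℕ-fin (suc m) ℕP.≤-refl)))
  transpose-raise-last (suc (suc y)) = FP.toℕ-injective (trans (cong toℕ (transpose-noMatchℕ _ _ _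
      (λ eq → ℕP.0≢1+n (trans (sym eq) raise≡))
      (λ eq → ℕP.<-irrefl (trans (sym raise≡) (trans eq (toℕ-fin (suc m) ℕP.≤-refl))) (s≤s (FP.toℕ<n y)))))
    (trans raise≡ (sym (FP.toℕ-inject₁ (suc y)))))
    where
    lemma : ∀ (d : Dec (toℕ y < m)) → raiseℕ≥2 m (toℕ y) d ≡ suc (toℕ y)
    lemma (yes _) = refl
    lemma (no y≮m) = ⊥-elim (y≮m (FP.toℕ<n y))
    raise≡ : toℕ (raise m (suc (suc y))) ≡ suc (toℕ y)
    raise≡ = trans (toℕ-raise m (suc (suc y)) ℕP.≤-refl) (lemma (toℕ y ℕP.<? m))

  -- Positions: block k is traversed by a subcode whose closing transposition exchanges the
  -- positions closeˡ k and closeʳ k; positions k is the product of the earlier ones.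
  swap₂₃^ : ℕ → Fin n → Fin n
  swap₂₃^ zero p = p
  swap₂₃^ (suc zero) p = transpose (fin 2) (fin 3) p
  swap₂₃^ (suc (suc k)) p = swap₂₃^ k p

  positions : ℕ → Fin n → Fin n
  positions zero p = p
  positions (suc zero) p = transpose (fin 3) (fin 4) p
  positions (suc (suc k)) p = swap₂₃^ k p

  closeˡ closeʳ : ℕ → Fin n
  closeˡ zero = fin 3
  closeˡ (suc zero) = fin 3
  closeˡ (suc (suc k)) = fin 2
  closeʳ zero = fin 4
  closeʳ (suc zero) = fin 4
  closeʳ (suc (suc k)) = fin 3

  closeˡ≢closeʳ : ∀ k → closeˡ k ≢ closeʳ k
  closeˡ≢closeʳ zero ()
  closeˡ≢closeʳ (suc zero) ()
  closeˡ≢closeʳ (suc (suc k)) ()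

  swap₂₃^-step : ∀ k p → swap₂₃^ k (transpose (fin 2) (fin 3) p) ≡ swap₂₃^ (suc k) p
  swap₂₃^-step zero p = refl
  swap₂₃^-step (suc zero) p = transpose-involutive (fin 2) (fin 3) p
  swap₂₃^-step (suc (suc k)) p = swap₂₃^-step k p

  positions-step : ∀ k p → positions k (transpose (closeˡ k) (closeʳ k) p) ≡ positions (suc k) p
  positions-step zero p = refl
  positions-step (suc zero) p = transpose-involutive (fin 3) (fin 4) p
  positions-step (suc (suc k)) p = swap₂₃^-step k p

  swap₂₃^-even : ∀ i p → swap₂₃^ (i + i) p ≡ p
  swap₂₃^-even zero p = refl
  swap₂₃^-even (suc i) p rewrite ℕP.+-suc i i = swap₂₃^-even i p

  -- The only use of the oddness of n: after the last block the positions are back in order.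
  positions-last : ∀ p → positions (suc m) p ≡ p
  positions-last = swap₂₃^-even j

  swap₂₃^-cases : ∀ k → (∀ p → swap₂₃^ k p ≡ p) ⊎ (∀ p → swap₂₃^ k p ≡ transpose (fin 2) (fin 3) p)
  swap₂₃^-cases zero = inj₁ λ _ → refl
  swap₂₃^-cases (suc zero) = inj₂ λ _ → refl
  swap₂₃^-cases (suc (suc k)) = swap₂₃^-cases k

  swap₂₃^-injective : ∀ k → Injective≡ (swap₂₃^ k)
  swap₂₃^-injective zero eq = eq
  swap₂₃^-injective (suc zero) eq = transpose-injective _ _ eq
  swap₂₃^-injective (suc (suc k)) eq = swap₂₃^-injective k eq

  positions-injective : ∀ k → Injective≡ (positions k)
  positions-injective zero eq = eq
  positions-injective (suc zero) eq = transpose-injective _ _ eq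
  positions-injective (suc (suc k)) eq = swap₂₃^-injective k eq

  swap₂₃^-0 : ∀ k → swap₂₃^ k zero ≡ zero
  swap₂₃^-0 zero = refl
  swap₂₃^-0 (suc zero) = refl
  swap₂₃^-0 (suc (suc k)) = swap₂₃^-0 k

  swap₂₃^-1 : ∀ k → swap₂₃^ k (suc zero) ≡ suc zero
  swap₂₃^-1 zero = refl
  swap₂₃^-1 (suc zero) = refl
  swap₂₃^-1 (suc (suc k)) = swap₂₃^-1 k

  positions-0 : ∀ k → positions k zero ≡ zero
  positions-0 zero = refl
  positions-0 (suc zero) = refl
  positions-0 (suc (suc k)) = swap₂₃^-0 k

  positions-1 : ∀ k → positions k (suc zero) ≡ suc zero
  positions-1 zero = refl
  positions-1 (suc zero) = refl
  positions-1 (suc (suc k)) = swap₂₃^-1 k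

  base : ℕ → Word n
  base k = tabulate (raise k ∘ positions k)

  lookup-base : ∀ k p → lookup (base k) p ≡ raise k (positions k p)
  lookup-base k = VP.lookup∘tabulate (raise k ∘ positions k)

  base-IsPerm : ∀ k → IsPerm (base k)
  base-IsPerm k = lookup-injective⇒Unique (base k) λ {p} {q} eq →
    positions-injective k (raise-injective k (trans (sym (lookup-base k p)) (trans eq (lookup-base k q))))

  closeValˡ closeValʳ : ℕ → Fin n
  closeValˡ k = lookup (base k) (closeˡ k)
  closeValʳ k = lookup (base k) (closeʳ k)

  base-close : ∀ k → act (closeValˡ k) (closeValʳ k) (base k) ≡ tabulate (raise k ∘ positions (suc k))
  base-close k = trans (act-lookup (base k) (closeˡ k) (closeʳ k) (base-IsPerm k))
    (VP.tabulate-cong λ p → trans (lookup-base k _) (cong (raise k) (positions-step k p)))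

  base-step : ∀ k → act (fin (suc k)) (fin (suc (suc k))) (act (closeValˡ k) (closeValʳ k) (base k)) ≡ base (suc k)
  base-step k = trans (cong (act (fin (suc k)) (fin (suc (suc k)))) (base-close k)) (act-tabulate _ _ (raise k ∘ positions (suc k)))

  base-last : act zero (fin (suc m)) (act (closeValˡ m) (closeValʳ m) (base m)) ≡ tabulate rotate
  base-last = begin
    act zero (fin (suc m)) (act (closeValˡ m) (closeValʳ m) (base m))      ≡⟨ cong (act zero (fin (suc m))) (base-close m) ⟩
    act zero (fin (suc m)) (tabulate (raise m ∘ positions (suc m)))        ≡⟨ act-tabulate _ _ (raise m ∘ positions (suc m)) ⟩
    tabulate (transpose zero (fin (suc m)) ∘ raise m ∘ positions (suc m))  ≡⟨ VP.tabulate-cong (λ p →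
                                                                               cong (transpose zero (fin (suc m)) ∘ raise m) (positions-last p)) ⟩
    tabulate (transpose zero (fin (suc m)) ∘ raise m)                      ≡⟨ VP.tabulate-cong transpose-raise-last ⟩
    tabulate rotate                                                        ∎
    where open ≡-Reasoning

  start : ℕ → ℕ → Word n
  start c k = V.map (rotateBy c) (base k)

  lookup-start : ∀ c k p → lookup (start c k) p ≡ rotateBy c (lookup (base k) p)
  lookup-start c k p = VP.lookup-map p (rotateBy c) (base k)

  start-IsPerm : ∀ c k → IsPerm (start c k)
  start-IsPerm c k = lookup-injective⇒Unique (start c k) λ {p} {q} eq →
    IsPerm⇒lookup-injective (base k) (base-IsPerm k)
      (rotateBy-injective c (trans (sym (lookup-start c k p)) (trans eq (lookup-start c k q))))

  start-injective : ∀ c k → Injective≡ (lookup (start c k))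
  start-injective c k = IsPerm⇒lookup-injective (start c k) (start-IsPerm c k)

  finish : ℕ → ℕ → Word n
  finish c k = act (rotateBy c (closeValˡ k)) (rotateBy c (closeValʳ k)) (start c k)

  finish-IsPerm : ∀ c k → IsPerm (finish c k)
  finish-IsPerm c k = act-IsPerm _ _ _ (start-IsPerm c k)

  closeVal≢ : ∀ c k → rotateBy c (closeValˡ k) ≢ rotateBy c (closeValʳ k)
  closeVal≢ c k eq = closeˡ≢closeʳ k (IsPerm⇒lookup-injective (base k) (base-IsPerm k) (rotateBy-injective c eq))

  map-rotateBy-act : ∀ c u v (w : Word n) → V.map (rotateBy c) (act u v w) ≡ act (rotateBy c u) (rotateBy c v) (V.map (rotateBy c) w)
  map-rotateBy-act c = map-conjugate (rotateBy c) (rotateBy-injective c)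

  start-step : ∀ c k → act (rotateBy c (fin (suc k))) (rotateBy c (fin (suc (suc k)))) (finish c k) ≡ start c (suc k)
  start-step c k = begin
    act (rotateBy c (fin (suc k))) (rotateBy c (fin (suc (suc k)))) (finish c k)
      ≡⟨ cong (act (rotateBy c (fin (suc k))) (rotateBy c (fin (suc (suc k))))) (map-rotateBy-act c _ _ (base k)) ⟨
    act (rotateBy c (fin (suc k))) (rotateBy c (fin (suc (suc k)))) (V.map (rotateBy c) (act (closeValˡ k) (closeValʳ k) (base k)))
      ≡⟨ map-rotateBy-act c _ _ _ ⟨
    V.map (rotateBy c) (act (fin (suc k)) (fin (suc (suc k))) (act (closeValˡ k) (closeValʳ k) (base k)))
      ≡⟨ cong (V.map (rotateBy c)) (base-step k) ⟩
    start c (suc k) ∎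
    where open ≡-Reasoning

  start-last : ∀ c → act (rotateBy c zero) (rotateBy c (fin (suc m))) (finish c m) ≡ start (suc c) 0
  start-last c = begin
    act (rotateBy c zero) (rotateBy c (fin (suc m))) (finish c m)
      ≡⟨ cong (act (rotateBy c zero) (rotateBy c (fin (suc m)))) (map-rotateBy-act c _ _ (base m)) ⟨
    act (rotateBy c zero) (rotateBy c (fin (suc m))) (V.map (rotateBy c) (act (closeValˡ m) (closeValʳ m) (base m)))
      ≡⟨ map-rotateBy-act c _ _ _ ⟨
    V.map (rotateBy c) (act zero (fin (suc m)) (act (closeValˡ m) (closeValʳ m) (base m)))
      ≡⟨ cong (V.map (rotateBy c)) base-last ⟩
    V.map (rotateBy c) (tabulate rotate)
      ≡⟨ VP.tabulate-∘ (rotateBy c) rotate ⟨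
    tabulate (rotateBy c ∘ rotate)
      ≡⟨ VP.tabulate-cong (rotateBy-rotate c) ⟩
    tabulate (rotateBy (suc c))
      ≡⟨ VP.tabulate-∘ (rotateBy (suc c)) id ⟩
    start (suc c) 0 ∎
    where open ≡-Reasoning

  start-0-0 : start 0 0 ≡ identity n
  start-0-0 = VP.map-id (base 0)

  start-n-0 : start n 0 ≡ identity n
  start-n-0 = trans (sym (VP.tabulate-∘ (rotateBy n) id)) (VP.tabulate-cong rotateBy-period)

  lookup-start-0 : ∀ c k → k ≤ m → lookup (start c k) zero ≡ rotateBy c zero
  lookup-start-0 c k k≤m = trans (lookup-start c k zero)
    (cong (rotateBy c) (trans (lookup-base k zero) (trans (cong (raise k) (positions-0 k)) (raise-0 k k≤m))))

  lookup-start-1 : ∀ c k → k ≤ m → lookup (start c k) (suc zero) ≡ rotateBy c (fin (suc k))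
  lookup-start-1 c k k≤m = trans (lookup-start c k (suc zero))
    (cong (rotateBy c) (trans (lookup-base k (suc zero)) (trans (cong (raise k) (positions-1 k)) (raise-1 k k≤m))))

  -- Every transposition met along the construction swaps two cyclically consecutive values,
  -- i.e. is a rotation of (0 top).
  CyclicEdge : Fin n → Fin n → Set
  CyclicEdge u v = ∃ λ α → SamePair u v (rotateBy α zero) (rotateBy α top)

  CyclicEdge-comm : ∀ {u v} → CyclicEdge u v → CyclicEdge v u
  CyclicEdge-comm (α , same) = α , SamePair-swap same

  consecutive⇒CyclicEdge : ∀ {u v} x → x < N → toℕ u ≡ suc x → toℕ v ≡ x → CyclicEdge u v
  consecutive⇒CyclicEdge {u} {v} x x<N u≡1+x v≡x = N ∸ x , inj₁ (FP.toℕ-injective u-eq , FP.toℕ-injective v-eq)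
    where
    u-eq : toℕ u ≡ toℕ (rotateBy (N ∸ x) zero)
    u-eq = sym (begin
      toℕ (rotateBy (N ∸ x) zero)           ≡⟨ cong (λ α → toℕ (rotateBy {N} α zero)) (ℕP.+-∸-assoc 1 x<N) ⟩
      toℕ (rotateBy (suc (N ∸ suc x)) zero) ≡⟨ toℕ-rotateBy-zero (N ∸ suc x) (ℕP.m∸n≤m N (suc x)) ⟩
      N ∸ (N ∸ suc x)                       ≡⟨ ℕP.m∸[m∸n]≡n x<N ⟩
      suc x                                 ≡⟨ u≡1+x ⟨
      toℕ u                                 ∎)
      where open ≡-Reasoning
    v-eq : toℕ v ≡ toℕ (rotateBy (N ∸ x) top)
    v-eq = trans v≡x (sym (trans (toℕ-rotateBy-fromℕ (N ∸ x) (ℕP.m∸n≤m N x)) (ℕP.m∸[m∸n]≡n (ℕP.<⇒≤ x<N))))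

  link-CyclicEdge : ∀ k → k < m → CyclicEdge (fin (suc k)) (fin (suc (suc k)))
  link-CyclicEdge k k<m = CyclicEdge-comm
    (consecutive⇒CyclicEdge (suc k) (s≤s k<m) (toℕ-fin (suc (suc k)) (s≤s k<m)) (toℕ-fin≤m (suc k) k<m))

  lastLink-CyclicEdge : CyclicEdge zero (fin (suc m))
  lastLink-CyclicEdge = 0 , inj₁ (refl , fin-top)

  toℕ-lookup-base : ∀ k p q {r} → swap₂₃^ k p ≡ q → toℕ (raise (suc (suc k)) q) ≡ r →
    toℕ (lookup (base (suc (suc k))) p) ≡ r
  toℕ-lookup-base k p q pq eq = trans (cong toℕ (trans (lookup-base (suc (suc k)) p) (cong (raise (suc (suc k))) pq))) eq

  closeVal-CyclicEdge : ∀ k → k ≤ m → CyclicEdge (closeValˡ k) (closeValʳ k)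
  closeVal-CyclicEdge zero _ = CyclicEdge-comm (consecutive⇒CyclicEdge 3 (s≤s (s≤s (s≤s (s≤s z≤n)))) refl refl)
  closeVal-CyclicEdge (suc zero) _ = consecutive⇒CyclicEdge 3 (s≤s (s≤s (s≤s (s≤s z≤n)))) refl refl
  closeVal-CyclicEdge (suc (suc k)) k+2≤m with swap₂₃^-cases k
  ... | inj₁ fixed = CyclicEdge-comm (consecutive⇒CyclicEdge 1 (s≤s (s≤s z≤n))
          (toℕ-lookup-base k (fin 3) (fin 3) (fixed (fin 3)) (toℕ-raise (suc (suc k)) (fin 3) k+2≤m))
          (toℕ-lookup-base k (fin 2) (fin 2) (fixed (fin 2)) (toℕ-raise (suc (suc k)) (fin 2) k+2≤m)))
  ... | inj₂ swapped = consecutive⇒CyclicEdge 1 (s≤s (s≤s z≤n))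
          (toℕ-lookup-base k (fin 2) (fin 3) (swapped (fin 2)) (toℕ-raise (suc (suc k)) (fin 3) k+2≤m))
          (toℕ-lookup-base k (fin 3) (fin 2) (swapped (fin 3)) (toℕ-raise (suc (suc k)) (fin 2) k+2≤m))

-- The inductive step: the code

module InductiveStep (j : ℕ) (code : BalancedCode (3 + (j + j)) zero (suc zero)) where
  open Blocks j

  code₁₂ : BalancedCode m (suc zero) (suc (suc zero))
  code₁₂ = BalancedCode-comm (Conjugation.conjugate (transpose zero (suc (suc zero))) (transpose-involutive _ _) code)

  subˡ subʳ : ℕ → Fin m
  subˡ zero = suc zero
  subˡ (suc zero) = suc zero
  subˡ (suc (suc k)) = zero
  subʳ zero = suc (suc zero)
  subʳ (suc zero) = suc (suc zero)
  subʳ (suc (suc k)) = suc zero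

  subcode : ∀ k → BalancedCode m (subˡ k) (subʳ k)
  subcode zero = code₁₂
  subcode (suc zero) = code₁₂
  subcode (suc (suc k)) = code

  shift₂ : Fin m → Fin n
  shift₂ p = suc (suc p)

  shift₂-injective : Injective≡ shift₂
  shift₂-injective refl = refl

  shift₂-subˡ : ∀ k → shift₂ (subˡ k) ≡ closeˡ k
  shift₂-subˡ zero = refl
  shift₂-subˡ (suc zero) = refl
  shift₂-subˡ (suc (suc k)) = refl

  shift₂-subʳ : ∀ k → shift₂ (subʳ k) ≡ closeʳ k
  shift₂-subʳ zero = refl
  shift₂-subʳ (suc zero) = refl
  shift₂-subʳ (suc (suc k)) = refl

  extend : Word m → Word n
  extend w = zero ∷ suc zero ∷ V.map shift₂ w

  lookup-extend : ∀ w p → lookup (extend w) (shift₂ p) ≡ shift₂ (lookup w p)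
  lookup-extend w p = VP.lookup-map p shift₂ w

  extend-act : ∀ u v w → extend (act u v w) ≡ act (shift₂ u) (shift₂ v) (extend w)
  extend-act u v w = cong₂ _∷_ (sym (transpose-noMatch (shift₂ u) (shift₂ v) zero (λ ()) (λ ())))
    (cong₂ _∷_ (sym (transpose-noMatch (shift₂ u) (shift₂ v) (suc zero) (λ ()) (λ ())))
      (map-conjugate shift₂ shift₂-injective u v w))

  extend-injective : Injective≡ extend
  extend-injective {u} {v} eq = lookup-ext λ p →
    shift₂-injective (trans (sym (lookup-extend u p)) (trans (cong (λ w → lookup w (shift₂ p)) eq) (lookup-extend v p)))

  extend-IsPerm : ∀ w → IsPerm w → IsPerm (extend w)
  extend-IsPerm w w-perm = lookup-injective⇒Unique (extend w) injective
    where
    0≢shift₂ : ∀ {x} → zero ≢ shift₂ x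
    0≢shift₂ ()
    1≢shift₂ : ∀ {x} → suc zero ≢ shift₂ x
    1≢shift₂ ()
    injective : Injective≡ (lookup (extend w))
    injective {zero} {zero} _ = refl
    injective {zero} {suc zero} ()
    injective {zero} {suc (suc q)} eq = ⊥-elim (0≢shift₂ (trans eq (lookup-extend w q)))
    injective {suc zero} {zero} ()
    injective {suc zero} {suc zero} _ = refl
    injective {suc zero} {suc (suc q)} eq = ⊥-elim (1≢shift₂ (trans eq (lookup-extend w q)))
    injective {suc (suc p)} {zero} eq = ⊥-elim (0≢shift₂ (trans (sym eq) (lookup-extend w p)))
    injective {suc (suc p)} {suc zero} eq = ⊥-elim (1≢shift₂ (trans (sym eq) (lookup-extend w p)))
    injective {suc (suc p)} {suc (suc q)} eq = cong shift₂ (IsPerm⇒lookup-injective w w-perm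
      (shift₂-injective (trans (sym (lookup-extend w p)) (trans eq (lookup-extend w q)))))

  extend-identity : extend (identity m) ≡ identity n
  extend-identity = lookup-ext same
    where
    same : ∀ p → lookup (extend (identity m)) p ≡ lookup (identity n) p
    same zero = refl
    same (suc zero) = refl
    same (suc (suc p)) = trans (lookup-extend (identity m) p)
      (trans (cong shift₂ (VP.lookup-allFin p)) (sym (VP.lookup-allFin (shift₂ p))))

  map-injective : ∀ {k} (f : Fin n → Fin n) → Injective≡ f → Injective≡ (V.map {n = k} f)
  map-injective f f-injective {u} {v} eq = lookup-ext λ p → f-injective
    (trans (sym (VP.lookup-map p f u)) (trans (cong (λ w → lookup w p) eq) (VP.lookup-map p f v)))

  blockEmbedding : ℕ → ℕ → ActEmbedding m n
  blockEmbedding c k = record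
    { embed = V.map (lookup (start c k)) ∘ extend
    ; relabel = lookup (start c k) ∘ shift₂
    ; relabel-injective = shift₂-injective ∘ start-injective c k
    ; embed-act = λ u v w → trans (cong (V.map (lookup (start c k))) (extend-act u v w))
        (map-conjugate (lookup (start c k)) (start-injective c k) _ _ (extend w))
    ; embed-injective = extend-injective ∘ map-injective _ (start-injective c k)
    ; embed-IsPerm = λ w w-perm → lookup-injective⇒Unique _ λ {p} {q} eq →
        IsPerm⇒lookup-injective (extend w) (extend-IsPerm w w-perm) (start-injective c k
          (trans (sym (VP.lookup-map p _ (extend w))) (trans eq (VP.lookup-map q _ (extend w)))))
    }

  module Block (c k : ℕ) = ActEmbedding.Image (blockEmbedding c k) (subcode k)

  embed-identity : ∀ c k → ActEmbedding.embed (blockEmbedding c k) (identity m) ≡ start c k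
  embed-identity c k = trans (cong (V.map (lookup (start c k))) extend-identity) (VP.map-lookup-allFin (start c k))

  segment : ℕ → ℕ → List (Word n)
  segment c k = Block.list c k

  segment-starts : ∀ c → StartsWith (segment c) (start c)
  segment-starts c k with BalancedCode.list (subcode k) | BalancedCode.head-list (subcode k)
  ... | x ∷ xs | refl = L.map embed xs , cong (_∷ L.map embed xs) (embed-identity c k)
    where open ActEmbedding (blockEmbedding c k) using (embed)

  last-segment : ∀ c k → last (segment c k) ≡ just (finish c k)
  last-segment c k = begin
    last (segment c k)                                                  ≡⟨ Block.last-list c k ⟩
    just (act (relabel (subˡ k)) (relabel (subʳ k)) (embed (identity m)))
      ≡⟨ cong just (cong₂ (λ a b → act a b (embed (identity m))) close-left close-right) ⟩
    just (act (rotateBy c (closeValˡ k)) (rotateBy c (closeValʳ k)) (embed (identity m)))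
      ≡⟨ cong (just ∘ act _ _) (embed-identity c k) ⟩
    just (finish c k)                                                   ∎
    where
    open ≡-Reasoning
    open ActEmbedding (blockEmbedding c k) using (embed; relabel)
    close-left : relabel (subˡ k) ≡ rotateBy c (closeValˡ k)
    close-left = trans (lookup-start c k (shift₂ (subˡ k))) (cong (rotateBy c ∘ lookup (base k)) (shift₂-subˡ k))
    close-right : relabel (subʳ k) ≡ rotateBy c (closeValʳ k)
    close-right = trans (lookup-start c k (shift₂ (subʳ k))) (cong (rotateBy c ∘ lookup (base k)) (shift₂-subʳ k))

  segment-lookup-0 : ∀ c k {π} → π ∈ segment c k → lookup π zero ≡ lookup (start c k) zero
  segment-lookup-0 c k π∈ with ∈-map⁻ _ π∈
  ... | w , _ , refl = VP.lookup-map zero (lookup (start c k)) (extend w)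

  segment-lookup-1 : ∀ c k {π} → π ∈ segment c k → lookup π (suc zero) ≡ lookup (start c k) (suc zero)
  segment-lookup-1 c k π∈ with ∈-map⁻ _ π∈
  ... | w , _ , refl = VP.lookup-map (suc zero) (lookup (start c k)) (extend w)

  round : ℕ → List (Word n)
  round c = concatUpTo (segment c) (suc m)

  round-starts : StartsWith round (λ c → start c 0)
  round-starts c = concatUpTo-∷ (segment-starts c) m

  last-round : ∀ c → last (round c) ≡ just (finish c m)
  last-round c = trans (last-concatUpTo (segment-starts c) m) (last-segment c m)

  link≢ : ∀ c k → k < m → rotateBy c (fin (suc k)) ≢ rotateBy c (fin (suc (suc k)))
  link≢ c k k<m eq = ℕP.1+n≢n (sym (fin-injective (suc k) (suc (suc k)) (ℕP.m≤n⇒m≤1+n k<m) (s≤s k<m) (rotateBy-injective c eq)))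

  lastLink≢ : ∀ c → rotateBy c zero ≢ rotateBy c (fin (suc m))
  lastLink≢ c eq = ℕP.0≢1+n (fin-injective 0 (suc m) z≤n ℕP.≤-refl (rotateBy-injective c eq))

  round-linked : ∀ c → Linked Adjacent (round c)
  round-linked c = Linked-concatUpTo (segment-starts c) (Block.linked c) (last-segment c) m
    λ k k<m → Adjacent-intro {π = finish c k} _ _ (link≢ c k k<m) (sym (start-step c k))

  round-unique : ∀ c → Unique (round c)
  round-unique c = Unique-concatUpTo (segment c) (λ π → lookup π (suc zero)) (λ k → rotateBy c (fin (suc k))) (suc m)
    (Block.unique c)
    (λ k k≤m π∈ → trans (segment-lookup-1 c k π∈) (lookup-start-1 c k (ℕP.≤-pred k≤m)))
    (λ k k′ k≤m k′≤m eq → ℕP.suc-injective (fin-injective (suc k) (suc k′) k≤m k′≤m (rotateBy-injective c eq)))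

  list : List (Word n)
  list = concatUpTo round n

  list-linked : Linked Adjacent list
  list-linked = Linked-concatUpTo round-starts round-linked last-round (suc m)
    λ c _ → Adjacent-intro {π = finish c m} _ _ (lastLink≢ c) (sym (start-last c))

  list-unique : Unique list
  list-unique = Unique-concatUpTo round (λ π → lookup π zero) (λ c → rotateBy c zero) n round-unique keyed rotateBy-zero-injective
    where
    keyed : ∀ c {π} → c < n → π ∈ round c → lookup π zero ≡ rotateBy c zero
    keyed c _ π∈ with ∈-concatUpTo⁻ (segment c) (suc m) π∈
    ... | k , k≤m , π∈seg = trans (segment-lookup-0 c k π∈seg) (lookup-start-0 c k (ℕP.≤-pred k≤m))

  list-sound : ∀ {π} → π ∈ list → IsPerm π
  list-sound π∈ with ∈-concatUpTo⁻ round n π∈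
  ... | c , _ , π∈round with ∈-concatUpTo⁻ (segment c) (suc m) π∈round
  ...   | k , _ , π∈seg = Block.sound c k π∈seg

  list-∷ : ∃ λ t → list ≡ start 0 0 ∷ t
  list-∷ = concatUpTo-∷ round-starts (suc m)

  head-list : head list ≡ just (identity n)
  head-list with list | list-∷
  ... | _ | t , refl = cong just start-0-0

  finish-last : finish (suc m) m ≡ act zero (suc zero) (identity n)
  finish-last = begin
    finish (suc m) m                         ≡⟨ act-involutive u v _ ⟨
    act u v (act u v (finish (suc m) m))     ≡⟨ cong (act u v) (trans (start-last (suc m)) start-n-0) ⟩
    act u v (identity n)                     ≡⟨ cong₂ (λ a b → act a b (identity n)) u≡1 v≡0 ⟩
    act (suc zero) zero (identity n)         ≡⟨ act-comm (suc zero) zero (identity n) ⟩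
    act zero (suc zero) (identity n)         ∎
    where
    open ≡-Reasoning
    u = rotateBy (suc m) zero
    v = rotateBy (suc m) (fin (suc m))
    u≡1 : u ≡ suc zero
    u≡1 = FP.toℕ-injective (trans (toℕ-rotateBy-zero m (ℕP.n≤1+n m)) (ℕP.m+n∸n≡m 1 m))
    v≡0 : v ≡ zero
    v≡0 = FP.toℕ-injective (trans (cong (toℕ ∘ rotateBy (suc m)) fin-top)
      (trans (toℕ-rotateBy-fromℕ (suc m) ℕP.≤-refl) (ℕP.n∸n≡0 (suc m))))

  last-list : last list ≡ just (act zero (suc zero) (identity n))
  last-list = trans (last-concatUpTo round-starts (suc m)) (trans (last-round (suc m)) (cong just finish-last))

  unshift₂ : Fin n → Fin m
  unshift₂ zero = zero
  unshift₂ (suc zero) = zero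
  unshift₂ (suc (suc p)) = p

  shift₂-unshift₂ : ∀ x → x ≢ zero → x ≢ suc zero → shift₂ (unshift₂ x) ≡ x
  shift₂-unshift₂ zero x≢0 _ = ⊥-elim (x≢0 refl)
  shift₂-unshift₂ (suc zero) _ x≢1 = ⊥-elim (x≢1 refl)
  shift₂-unshift₂ (suc (suc p)) _ _ = refl

  relabel-extend-surjective : ∀ (X π : Word n) → IsPerm X → IsPerm π →
    lookup π zero ≡ lookup X zero → lookup π (suc zero) ≡ lookup X (suc zero) →
    ∃ λ w → IsPerm w × V.map (lookup X) (extend w) ≡ π
  relabel-extend-surjective X π X-perm π-perm π₀≡X₀ π₁≡X₁ = w , w-perm , lookup-ext agree
    where
    X⁻¹ : Fin n → Fin n
    X⁻¹ y = proj₁ (IsPerm⇒lookup-surjective X X-perm y)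
    X∘X⁻¹ : ∀ y → lookup X (X⁻¹ y) ≡ y
    X∘X⁻¹ y = proj₂ (IsPerm⇒lookup-surjective X X-perm y)
    π-injective = IsPerm⇒lookup-injective π π-perm
    z : Fin m → Fin n
    z p = X⁻¹ (lookup π (shift₂ p))
    z≢0 : ∀ p → z p ≢ zero
    z≢0 p eq with π-injective {shift₂ p} {zero} (trans (sym (X∘X⁻¹ _)) (trans (cong (lookup X) eq) (sym π₀≡X₀)))
    ... | ()
    z≢1 : ∀ p → z p ≢ suc zero
    z≢1 p eq with π-injective {shift₂ p} {suc zero} (trans (sym (X∘X⁻¹ _)) (trans (cong (lookup X) eq) (sym π₁≡X₁)))
    ... | ()
    w : Word m
    w = tabulate (unshift₂ ∘ z)
    shift₂-w : ∀ p → shift₂ (lookup w p) ≡ z p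
    shift₂-w p = trans (cong shift₂ (VP.lookup∘tabulate (unshift₂ ∘ z) p)) (shift₂-unshift₂ (z p) (z≢0 p) (z≢1 p))
    w-perm : IsPerm w
    w-perm = lookup-injective⇒Unique w λ {p} {q} eq → shift₂-injective (π-injective
      (trans (sym (X∘X⁻¹ _)) (trans (cong (lookup X) (trans (sym (shift₂-w p)) (trans (cong shift₂ eq) (shift₂-w q)))) (X∘X⁻¹ _))))
    agree : ∀ p → lookup (V.map (lookup X) (extend w)) p ≡ lookup π p
    agree zero = sym π₀≡X₀
    agree (suc zero) = sym π₁≡X₁
    agree (suc (suc p)) = trans (VP.lookup-map (shift₂ p) (lookup X) (extend w))
      (trans (cong (lookup X) (trans (lookup-extend w p) (shift₂-w p))) (X∘X⁻¹ _))

  -- π lies in the segment fixed by its first two values.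
  list-complete : ∀ π → IsPerm π → π ∈ list
  list-complete π π-perm with rotateBy-zero-surjective (lookup π zero)
  ... | c , c<n , π₀≡ with injective⇒surjective (rotateBy c) (rotateBy-injective c) (lookup π (suc zero))
  ...   | zero , π₁≡ = ⊥-elim (0≢1 (IsPerm⇒lookup-injective π π-perm (trans (sym π₀≡) π₁≡)))
    where
    0≢1 : zero {N} ≢ suc zero
    0≢1 ()
  ...   | suc y , π₁≡ = ∈-concatUpTo⁺ round n c c<n (∈-concatUpTo⁺ (segment c) (suc m) k (s≤s k≤m)
          (subst (_∈ segment c k) embed-w≡π (∈-map⁺ _ (BalancedCode.complete (subcode k) w w-perm))))
    where
    k = toℕ y
    k≤m : k ≤ m
    k≤m = FP.toℕ≤pred[n] y
    fin-k : fin (suc k) ≡ suc y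
    fin-k = FP.toℕ-injective (toℕ-fin (suc k) (s≤s k≤m))
    decomposition = relabel-extend-surjective (start c k) π (start-IsPerm c k) π-perm
      (trans (sym π₀≡) (sym (lookup-start-0 c k k≤m)))
      (trans (sym π₁≡) (trans (cong (rotateBy c) (sym fin-k)) (sym (lookup-start-1 c k k≤m))))
    w = proj₁ decomposition
    w-perm = proj₁ (proj₂ decomposition)
    embed-w≡π = proj₂ (proj₂ decomposition)

  prefix-unrelabelled : ∀ c k → k ≤ m → ∀ s →
    lookup (start c k) (shift₂ s) ≢ rotateBy c zero × lookup (start c k) (shift₂ s) ≢ rotateBy c (fin (suc k))
  prefix-unrelabelled c k k≤m s =
    (λ eq → 0≢shift₂ (start-injective c k (trans (lookup-start-0 c k k≤m) (sym eq))))
    , (λ eq → 1≢shift₂ (start-injective c k (trans (lookup-start-1 c k k≤m) (sym eq))))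
    where
    0≢shift₂ : zero ≢ shift₂ s
    0≢shift₂ ()
    1≢shift₂ : suc zero ≢ shift₂ s
    1≢shift₂ ()

  relabel-surjective : ∀ c k → k ≤ m → ∀ y → y ≢ rotateBy c zero → y ≢ rotateBy c (fin (suc k)) →
    ∃ λ s → lookup (start c k) (shift₂ s) ≡ y
  relabel-surjective c k k≤m y y≢₀ y≢₁ with IsPerm⇒lookup-surjective (start c k) (start-IsPerm c k) y
  ... | p , p↦y = unshift₂ p , trans (cong (lookup (start c k)) (shift₂-unshift₂ p
        (λ p≡0 → y≢₀ (trans (sym p↦y) (trans (cong (lookup (start c k)) p≡0) (lookup-start-0 c k k≤m))))
        (λ p≡1 → y≢₁ (trans (sym p↦y) (trans (cong (lookup (start c k)) p≡1) (lookup-start-1 c k k≤m)))))) p↦y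

  module Balance (i j : Fin n) (i≢j : i ≢ j) where

    occ? : Decidable (StepBy i j)
    occ? = stepBy? i j

    χ : Fin n → Fin n → ℕ
    χ u v = indicator (samePair? u v i j)

    χ-comm : ∀ u v → χ u v ≡ χ v u
    χ-comm u v = indicator-cong (samePair? u v i j) (samePair? v u i j) SamePair-swap SamePair-swap

    count-act : ∀ Y u v → IsPerm Y → u ≢ v → count occ? ((Y , act u v Y) ∷ []) ≡ χ u v
    count-act Y u v Y-perm u≢v = trans (count-singleton occ? (Y , act u v Y)) (indicator-cong _ (samePair? u v i j)
      (act≡act⇒SamePair u v i j Y Y-perm u≢v) (SamePair⇒act≡act u v i j Y))

    count-act⁻¹ : ∀ Y u v → IsPerm Y → u ≢ v → count occ? ((act u v Y , Y) ∷ []) ≡ χ u v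
    count-act⁻¹ Y u v Y-perm u≢v = trans (count-singleton occ? (act u v Y , Y)) (indicator-cong _ (samePair? u v i j)
      (λ st → act≡act⇒SamePair u v i j Y Y-perm u≢v (sym (trans (cong (act i j) st) (act-involutive i j (act u v Y)))))
      (λ same → trans (sym (act-involutive i j Y)) (cong (act i j) (sym (SamePair⇒act≡act u v i j Y same)))))

    Occ : ℕ → ℕ → ℕ
    Occ c k = occurrences i j (segment c k)

    closeχ linkχ : ℕ → ℕ → ℕ
    closeχ c k = χ (rotateBy c (closeValˡ k)) (rotateBy c (closeValʳ k))
    linkχ c k = χ (rotateBy c (fin (suc k))) (rotateBy c (fin (suc (suc k))))

    lastLinkχ : ℕ → ℕ
    lastLinkχ c = χ (rotateBy c zero) (rotateBy c (fin (suc m)))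

    -- Leaving block (c, k) by (u v) instead of closing it up by its subcode's transposition.
    block-count : ∀ c k z u v → z ≡ act u v (finish c k) → u ≢ v →
      count occ? (pairsTo z (segment c k)) + closeχ c k ≡ Occ c k + χ u v
    block-count c k z u v z≡ u≢v with segment c k | segment-starts c k | last-segment c k
    ... | _ | tl , refl | last≡ = begin
      count occ? (pairsTo z (X ∷ tl)) + closeχ c k                        ≡⟨ cong (count occ? (pairsTo z (X ∷ tl)) +_) closing ⟨
      count occ? (pairsTo z (X ∷ tl)) + count occ? ((last∷ X tl , X) ∷ []) ≡⟨ count-pairsTo-retarget occ? z X X tl ⟩
      count occ? (pairsTo X (X ∷ tl)) + count occ? ((last∷ X tl , z) ∷ []) ≡⟨ cong₂ _+_ (cong (count occ?) (sym (cyclicPairs-∷ X tl))) exit ⟩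
      occurrences i j (X ∷ tl) + χ u v                                    ∎
      where
      open ≡-Reasoning
      X = start c k
      F≡ : last∷ X tl ≡ finish c k
      F≡ = last∷-unique X tl last≡
      closing : count occ? ((last∷ X tl , X) ∷ []) ≡ closeχ c k
      closing = trans (cong (λ F → count occ? ((F , X) ∷ [])) F≡) (count-act⁻¹ X _ _ (start-IsPerm c k) (closeVal≢ c k))
      exit : count occ? ((last∷ X tl , z) ∷ []) ≡ χ u v
      exit = trans (cong₂ (λ F z′ → count occ? ((F , z′) ∷ [])) F≡ z≡) (count-act (finish c k) u v (finish-IsPerm c k) u≢v)

    roundPairs : ℕ → ℕ
    roundPairs c = count occ? (pairsTo (start (suc c) 0) (round c))

    roundPairs-split : ∀ c → roundPairs c ≡
      ∑[ k < m ] count occ? (pairsTo (start c (suc k)) (segment c k)) + count occ? (pairsTo (start (suc c) 0) (segment c m))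
    roundPairs-split c = trans (cong (count occ?) (pairsTo-concatUpTo (segment-starts c) (start (suc c) 0) m))
      (trans (count-++ occ? (concatUpTo inner m) _) (cong (_+ count occ? (pairsTo (start (suc c) 0) (segment c m))) (count-concatUpTo occ? inner m)))
      where
      inner : ℕ → List (Word n × Word n)
      inner k = pairsTo (start c (suc k)) (segment c k)

    round-count : ∀ c → roundPairs c + sumUpTo (suc m) (closeχ c) ≡ sumUpTo (suc m) (Occ c) + (sumUpTo m (linkχ c) + lastLinkχ c)
    round-count c = begin
      roundPairs c + (sumUpTo m (closeχ c) + closeχ c m)
        ≡⟨ cong (_+ (sumUpTo m (closeχ c) + closeχ c m)) (roundPairs-split c) ⟩
      (∑[ k < m ] inner k + lastInner) + (sumUpTo m (closeχ c) + closeχ c m)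
        ≡⟨ +-interchange (sumUpTo m inner) lastInner (sumUpTo m (closeχ c)) (closeχ c m) ⟩
      (∑[ k < m ] inner k + sumUpTo m (closeχ c)) + (lastInner + closeχ c m)
        ≡⟨ cong₂ _+_ inner-blocks (block-count c m (start (suc c) 0) _ _ (sym (start-last c)) (lastLink≢ c)) ⟩
      (sumUpTo m (Occ c) + sumUpTo m (linkχ c)) + (Occ c m + lastLinkχ c)
        ≡⟨ +-interchange (sumUpTo m (Occ c)) (sumUpTo m (linkχ c)) (Occ c m) (lastLinkχ c) ⟩
      (sumUpTo m (Occ c) + Occ c m) + (sumUpTo m (linkχ c) + lastLinkχ c) ∎
      where
      open ≡-Reasoning
      inner : ℕ → ℕ
      inner k = count occ? (pairsTo (start c (suc k)) (segment c k))
      lastInner = count occ? (pairsTo (start (suc c) 0) (segment c m))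
      inner-blocks : ∑[ k < m ] inner k + sumUpTo m (closeχ c) ≡ sumUpTo m (Occ c) + sumUpTo m (linkχ c)
      inner-blocks = trans (sym (∑-distrib-+ m inner (closeχ c)))
        (trans (∑-cong m λ k k<m → block-count c k (start c (suc k)) _ _ (sym (start-step c k)) (link≢ c k k<m))
          (∑-distrib-+ m (Occ c) (linkχ c)))

    edgeTotal : ℕ
    edgeTotal = ∑[ c < n ] χ (rotateBy c zero) (rotateBy c top)

    rotation-sum : ∀ {u v} → CyclicEdge u v → ∑[ c < n ] χ (rotateBy c u) (rotateBy c v) ≡ edgeTotal
    rotation-sum (α , same) = trans (∑-cong n λ c _ → rotated same c)
      (∑-periodic n φ (λ c → cong₂ χ (rotateBy-periodic c zero) (rotateBy-periodic c top)) α)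
      where
      φ : ℕ → ℕ
      φ c = χ (rotateBy c zero) (rotateBy c top)
      rotated : ∀ {u v} → SamePair u v (rotateBy α zero) (rotateBy α top) → ∀ c → χ (rotateBy c u) (rotateBy c v) ≡ φ (c + α)
      rotated (inj₁ (refl , refl)) c = sym (cong₂ χ (rotateBy-+ c α zero) (rotateBy-+ c α top))
      rotated (inj₂ (refl , refl)) c = trans (χ-comm _ _) (sym (cong₂ χ (rotateBy-+ c α zero) (rotateBy-+ c α top)))

    closings-total : ∑[ c < n ] sumUpTo (suc m) (closeχ c) ≡ suc m * edgeTotal
    closings-total = begin
      ∑[ c < n ] sumUpTo (suc m) (closeχ c)   ≡⟨ ∑-comm n (suc m) closeχ ⟩
      ∑[ k < suc m ] ∑[ c < n ] closeχ c k     ≡⟨ ∑-cong (suc m) (λ k k≤m → rotation-sum (closeVal-CyclicEdge k (ℕP.≤-pred k≤m))) ⟩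
      ∑[ k < suc m ] edgeTotal                     ≡⟨ ∑-const (suc m) edgeTotal ⟩
      suc m * edgeTotal                            ∎
      where open ≡-Reasoning

    links-total : ∑[ c < n ] (sumUpTo m (linkχ c) + lastLinkχ c) ≡ suc m * edgeTotal
    links-total = begin
      ∑[ c < n ] (sumUpTo m (linkχ c) + lastLinkχ c)          ≡⟨ ∑-distrib-+ n _ lastLinkχ ⟩
      ∑[ c < n ] sumUpTo m (linkχ c) + sumUpTo n lastLinkχ    ≡⟨ cong₂ _+_ (∑-comm n m linkχ) (rotation-sum lastLink-CyclicEdge) ⟩
      ∑[ k < m ] ∑[ c < n ] linkχ c k + edgeTotal                   ≡⟨ cong (_+ edgeTotal) (∑-cong m λ k k<m → rotation-sum (link-CyclicEdge k k<m)) ⟩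
      ∑[ k < m ] edgeTotal + edgeTotal                                  ≡⟨ cong (_+ edgeTotal) (∑-const m edgeTotal) ⟩
      m * edgeTotal + edgeTotal                                         ≡⟨ ℕP.+-comm (m * edgeTotal) edgeTotal ⟩
      suc m * edgeTotal                                            ∎
      where open ≡-Reasoning

    occurrences-list : occurrences i j list ≡ ∑[ c < n ] roundPairs c
    occurrences-list = begin
      count occ? (cyclicPairs list)                ≡⟨ cong (count occ? ∘ cyclicPairs) list≡ ⟩
      count occ? (cyclicPairs (start 0 0 ∷ t))     ≡⟨ cong (count occ?) (cyclicPairs-∷ (start 0 0) t) ⟩
      count occ? (pairsTo (start 0 0) (start 0 0 ∷ t)) ≡⟨ cong (λ z → count occ? (pairsTo z (start 0 0 ∷ t))) (trans start-0-0 (sym start-n-0)) ⟩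
      count occ? (pairsTo (start n 0) (start 0 0 ∷ t)) ≡⟨ cong (count occ? ∘ pairsTo (start n 0)) list≡ ⟨
      count occ? (pairsTo (start n 0) list)        ≡⟨ cong (count occ?) (pairsTo-concatUpTo round-starts (start n 0) (suc m)) ⟩
      count occ? (concatUpTo (λ c → pairsTo (start (suc c) 0) (round c)) n) ≡⟨ count-concatUpTo occ? _ n ⟩
      ∑[ c < n ] roundPairs c                      ∎
      where
      open ≡-Reasoning
      t = proj₁ list-∷
      list≡ = proj₂ list-∷

    occurrences-list≡segments : occurrences i j list ≡ ∑[ c < n ] sumUpTo (suc m) (Occ c)
    occurrences-list≡segments = ℕP.+-cancelʳ-≡ (suc m * edgeTotal) _ _ (begin
      occurrences i j list + suc m * edgeTotal
        ≡⟨ cong₂ _+_ occurrences-list (sym closings-total) ⟩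
      ∑[ c < n ] roundPairs c + ∑[ c < n ] sumUpTo (suc m) (closeχ c)
        ≡⟨ ∑-distrib-+ n roundPairs _ ⟨
      ∑[ c < n ] (roundPairs c + sumUpTo (suc m) (closeχ c))
        ≡⟨ ∑-cong n (λ c _ → round-count c) ⟩
      ∑[ c < n ] (sumUpTo (suc m) (Occ c) + (sumUpTo m (linkχ c) + lastLinkχ c))
        ≡⟨ ∑-distrib-+ n _ _ ⟩
      ∑[ c < n ] sumUpTo (suc m) (Occ c) + ∑[ c < n ] (sumUpTo m (linkχ c) + lastLinkχ c)
        ≡⟨ cong (∑[ c < n ] sumUpTo (suc m) (Occ c) +_) links-total ⟩
      ∑[ c < n ] sumUpTo (suc m) (Occ c) + suc m * edgeTotal ∎)
      where open ≡-Reasoning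

    Hits : Fin n → Set
    Hits y = y ≡ i ⊎ y ≡ j

    hits? : ∀ y → Dec (Hits y)
    hits? y = (y ≟ᶠ i) ⊎-dec (y ≟ᶠ j)

    avoids : Fin n → ℕ
    avoids y = indicator (¬? (hits? y))

    avoids-cases : ∀ y → (Hits y × avoids y ≡ 0) ⊎ (¬ Hits y × avoids y ≡ 1)
    avoids-cases y with hits? y
    ... | yes hit = inj₁ (hit , refl)
    ... | no miss = inj₂ (miss , refl)

    avoids-split : ∀ y → avoids y + (indicator (y ≟ᶠ i) + indicator (y ≟ᶠ j)) ≡ 1
    avoids-split y with y ≟ᶠ i | y ≟ᶠ j
    ... | no _ | no _ = refl
    ... | yes _ | no _ = refl
    ... | no _ | yes _ = refl
    ... | yes y≡i | yes y≡j = ⊥-elim (i≢j (trans (sym y≡i) y≡j))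

    avoids-sum : ∀ (h : ℕ → Fin n) ℓ → (∀ k k′ → k < ℓ → k′ < ℓ → h k ≡ h k′ → k ≡ k′) →
      (∃ λ k → k < ℓ × h k ≡ i) → (∃ λ k → k < ℓ × h k ≡ j) → ∑[ k < ℓ ] avoids (h k) + 2 ≡ ℓ
    avoids-sum h ℓ h-injective (kᵢ , kᵢ<ℓ , h↦i) (kⱼ , kⱼ<ℓ , h↦j) = begin
      ∑[ k < ℓ ] avoids (h k) + 2
        ≡⟨ cong (∑[ k < ℓ ] avoids (h k) +_) (cong₂ _+_ (once i kᵢ kᵢ<ℓ h↦i) (once j kⱼ kⱼ<ℓ h↦j)) ⟨
      ∑[ k < ℓ ] avoids (h k) + (∑[ k < ℓ ] indicator (h k ≟ᶠ i) + ∑[ k < ℓ ] indicator (h k ≟ᶠ j))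
        ≡⟨ cong (∑[ k < ℓ ] avoids (h k) +_) (∑-distrib-+ ℓ _ _) ⟨
      ∑[ k < ℓ ] avoids (h k) + ∑[ k < ℓ ] (indicator (h k ≟ᶠ i) + indicator (h k ≟ᶠ j))
        ≡⟨ ∑-distrib-+ ℓ _ _ ⟨
      ∑[ k < ℓ ] (avoids (h k) + (indicator (h k ≟ᶠ i) + indicator (h k ≟ᶠ j)))
        ≡⟨ ∑-cong ℓ (λ k _ → avoids-split (h k)) ⟩
      ∑[ k < ℓ ] 1
        ≡⟨ trans (∑-const ℓ 1) (ℕP.*-identityʳ ℓ) ⟩
      ℓ ∎
      where
      open ≡-Reasoning
      once : ∀ y k → k < ℓ → h k ≡ y → ∑[ k < ℓ ] indicator (h k ≟ᶠ y) ≡ 1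
      once y k k<ℓ h↦y = ∑-indicator-unique _≟ᶠ_ h y ℓ k k<ℓ h↦y
        λ k′ k′<ℓ h′↦y → h-injective k′ k k′<ℓ k<ℓ (trans h′↦y (sym h↦y))

    -- Within a round the second value runs over all values except the first one.
    inner-avoids : ∀ c → ¬ Hits (rotateBy c zero) → ∑[ k < suc m ] avoids (rotateBy c (fin (suc k))) ≡ m ∸ 1
    inner-avoids c miss = ℕP.+-cancelʳ-≡ 2 _ _ (trans
      (avoids-sum (λ k → rotateBy c (fin (suc k))) (suc m) injective (second i (miss ∘ inj₁)) (second j (miss ∘ inj₂)))
      (ℕP.+-comm 2 (m ∸ 1)))
      where
      injective : ∀ k k′ → k < suc m → k′ < suc m → rotateBy c (fin (suc k)) ≡ rotateBy c (fin (suc k′)) → k ≡ k′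
      injective k k′ k≤m k′≤m eq = ℕP.suc-injective (fin-injective (suc k) (suc k′) k≤m k′≤m (rotateBy-injective c eq))
      second : ∀ y → rotateBy c zero ≢ y → ∃ λ k → k < suc m × rotateBy c (fin (suc k)) ≡ y
      second y first≢y with injective⇒surjective (rotateBy c) (rotateBy-injective c) y
      ... | zero , eq = ⊥-elim (first≢y eq)
      ... | suc x , eq = toℕ x , s≤s (FP.toℕ≤pred[n] x) ,
            trans (cong (rotateBy c) (FP.toℕ-injective (toℕ-fin (suc (toℕ x)) (s≤s (FP.toℕ≤pred[n] x))))) eq

    outer-avoids : ∑[ c < n ] avoids (rotateBy c zero) ≡ m
    outer-avoids = ℕP.+-cancelʳ-≡ 2 _ _ (trans
      (avoids-sum (λ c → rotateBy c zero) n rotateBy-zero-injective (rotateBy-zero-surjective i) (rotateBy-zero-surjective j))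
      (ℕP.+-comm 2 m))

    SamePair-Hits : ∀ {u v b} → Hits b → SamePair u v i j → u ≡ b ⊎ v ≡ b
    SamePair-Hits (inj₁ b≡i) (inj₁ (u≡i , _)) = inj₁ (trans u≡i (sym b≡i))
    SamePair-Hits (inj₂ b≡j) (inj₁ (_ , v≡j)) = inj₂ (trans v≡j (sym b≡j))
    SamePair-Hits (inj₁ b≡i) (inj₂ (_ , v≡i)) = inj₂ (trans v≡i (sym b≡i))
    SamePair-Hits (inj₂ b≡j) (inj₂ (u≡j , _)) = inj₁ (trans u≡j (sym b≡j))

    never : ∀ {A : Set} (f : A → Fin n) {b} → (∀ s → f s ≢ b) → Hits b → ∀ s t → ¬ SamePair (f s) (f t) i j
    never f avoid hit s t same with SamePair-Hits hit same
    ... | inj₁ fs≡b = avoid s fs≡b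
    ... | inj₂ ft≡b = avoid t ft≡b

    K : ℕ
    K = 2 * ((m ∸ 2) !)

    -- A step inside block (c, k) never moves its two prefix values; any other (i j) is the relabelling of a
    -- transposition of the balanced subcode.
    segment-occurrences : ∀ c k → k ≤ m → Occ c k ≡ avoids (rotateBy c zero) * (avoids (rotateBy c (fin (suc k))) * K)
    segment-occurrences c k k≤m with avoids-cases (rotateBy c zero) | avoids-cases (rotateBy c (fin (suc k)))
    ... | inj₁ (hit , a≡0) | _ rewrite a≡0 = Block.occurrences-unrelabelled c k i j (never _ (proj₁ ∘ prefix-unrelabelled c k k≤m) hit)
    ... | inj₂ (_ , a≡1) | inj₁ (hit , b≡0) rewrite a≡1 | b≡0 = Block.occurrences-unrelabelled c k i j (never _ (proj₂ ∘ prefix-unrelabelled c k k≤m) hit)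
    ... | inj₂ (miss₀ , a≡1) | inj₂ (miss₁ , b≡1) rewrite a≡1 | b≡1 = begin
      occurrences i j (segment c k)                       ≡⟨ cong₂ (λ x y → occurrences x y (segment c k)) (proj₂ sᵢ) (proj₂ sⱼ) ⟨
      occurrences (relabel (proj₁ sᵢ)) (relabel (proj₁ sⱼ)) (segment c k) ≡⟨ Block.occurrences-relabel c k (proj₁ sᵢ) (proj₁ sⱼ) ⟩
      occurrences (proj₁ sᵢ) (proj₁ sⱼ) (BalancedCode.list (subcode k))  ≡⟨ BalancedCode.balanced (subcode k) _ _ sᵢ≢sⱼ ⟩
      K                                                   ≡⟨ trans (ℕP.*-identityˡ (1 * K)) (ℕP.*-identityˡ K) ⟨
      1 * (1 * K)                                         ∎
      where
      open ≡-Reasoning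
      open ActEmbedding (blockEmbedding c k) using (relabel; relabel-injective)
      sᵢ = relabel-surjective c k k≤m i (miss₀ ∘ inj₁ ∘ sym) (miss₁ ∘ inj₁ ∘ sym)
      sⱼ = relabel-surjective c k k≤m j (miss₀ ∘ inj₂ ∘ sym) (miss₁ ∘ inj₂ ∘ sym)
      sᵢ≢sⱼ : proj₁ sᵢ ≢ proj₁ sⱼ
      sᵢ≢sⱼ eq = i≢j (trans (sym (proj₂ sᵢ)) (trans (cong relabel eq) (proj₂ sⱼ)))

    round-segments : ∀ c → sumUpTo (suc m) (Occ c) ≡ avoids (rotateBy c zero) * ((m ∸ 1) * K)
    round-segments c = begin
      sumUpTo (suc m) (Occ c)                                  ≡⟨ ∑-cong (suc m) (λ k k≤m → segment-occurrences c k (ℕP.≤-pred k≤m)) ⟩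
      ∑[ k < suc m ] (a * (avoids (second k) * K))             ≡⟨ ∑-*ˡ (suc m) a _ ⟩
      a * ∑[ k < suc m ] (avoids (second k) * K)               ≡⟨ cong (a *_) (∑-*ʳ (suc m) K (avoids ∘ second)) ⟩
      a * (∑[ k < suc m ] avoids (second k) * K)               ≡⟨ inner (avoids-cases (rotateBy c zero)) ⟩
      a * ((m ∸ 1) * K)                                        ∎
      where
      open ≡-Reasoning
      a = avoids (rotateBy c zero)
      second : ℕ → Fin n
      second k = rotateBy c (fin (suc k))
      inner : (Hits (rotateBy c zero) × a ≡ 0) ⊎ (¬ Hits (rotateBy c zero) × a ≡ 1) →
        a * (∑[ k < suc m ] avoids (second k) * K) ≡ a * ((m ∸ 1) * K)
      inner (inj₁ (_ , a≡0)) = trans (cong (_* (∑[ k < suc m ] avoids (second k) * K)) a≡0) (sym (cong (_* ((m ∸ 1) * K)) a≡0))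
      inner (inj₂ (miss , _)) = cong (λ s → a * (s * K)) (inner-avoids c miss)

    segments-total : ∑[ c < n ] sumUpTo (suc m) (Occ c) ≡ 2 * (m !)
    segments-total = begin
      ∑[ c < n ] sumUpTo (suc m) (Occ c)                   ≡⟨ ∑-cong n (λ c _ → round-segments c) ⟩
      ∑[ c < n ] (avoids (rotateBy c zero) * ((m ∸ 1) * K)) ≡⟨ ∑-*ʳ n ((m ∸ 1) * K) (λ c → avoids (rotateBy c zero)) ⟩
      ∑[ c < n ] avoids (rotateBy c zero) * ((m ∸ 1) * K)   ≡⟨ cong (_* ((m ∸ 1) * K)) outer-avoids ⟩
      m * ((m ∸ 1) * (2 * (m ∸ 2) !))                      ≡⟨ *-pull-2 m (m ∸ 1) ((m ∸ 2) !) ⟩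
      2 * (m * ((m ∸ 1) * (m ∸ 2) !))                      ∎
      where open ≡-Reasoning

    balanced : occurrences i j list ≡ 2 * (m !)
    balanced = trans occurrences-list≡segments segments-total

  stepCode : BalancedCode n zero (suc zero)
  stepCode = record
    { list = list
    ; complete = list-complete
    ; sound = list-sound
    ; unique = list-unique
    ; linked = list-linked
    ; balanced = Balance.balanced
    ; head-list = head-list
    ; last-list = last-list
    ; a≢b = λ ()
    }

-- Odd n

oddCode : ∀ j → BalancedCode (3 + (j + j)) zero (suc zero)
oddCode zero = code₃
oddCode (suc j) = subst (λ k → BalancedCode (4 + k) zero (suc zero)) (sym (ℕP.+-suc j j)) (InductiveStep.stepCode j (oddCode j))

odd⇒3+double : ∀ m → (3 + m) % 2 ≡ 1 → ∃ λ j → m ≡ j + j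
odd⇒3+double zero _ = zero , refl
odd⇒3+double (suc (suc m)) odd with odd⇒3+double m (trans (sym (trans (cong (_% 2) (ℕP.+-comm 2 (3 + m))) ([m+n]%n≡m%n (3 + m) 2))) odd)
... | j , refl = suc j , cong suc (sym (ℕP.+-suc j j))

BalancedCode⇒GrayCode : ∀ {n a b} → BalancedCode n a b →
  ∃ λ (L : List (Word n)) →
    IsGrayCode n L × (IsCyclic n L × (IsBalanced n L ×
    ((head L ≡ just (identity n)) × (last L ≡ just (act a b (identity n))))))
BalancedCode⇒GrayCode {n} {a} {b} C = list
  , (complete , (λ _ → sound) , unique , linked)
  , (identity n , act a b (identity n) , head-list , last-list
     , Adjacent-intro a b a≢b (sym (act-involutive a b (identity n))))
  , (λ i j i<j → balanced i j (λ i≡j → ℕP.<-irrefl (cong toℕ i≡j) i<j))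
  , head-list , last-list
  where open BalancedCode C

proposition4p7 : (n : ℕ) → (h : 3 ≤ n) → n % 2 ≡ 1 →
    ∃ λ (L : List (Word n)) →
      IsGrayCode n L × (IsCyclic n L × (IsBalanced n L ×
      ((head L ≡ just (identity n)) ×
      (last L ≡ just (swapLast n h (identity n))))))
proposition4p7 (suc (suc (suc m))) (s≤s (s≤s (s≤s z≤n))) odd with odd⇒3+double m odd
... | j , refl = BalancedCode⇒GrayCode (BalancedCode-comm (Conjugation.conjugate opposite FP.opposite-involutive (oddCode j)))
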